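{- Let $\mathcal{S}(132)$ denote the set of all permutations of all lengths $n\ge 0$ (including the empty permutation) that avoid the classical pattern $1\text{ - }3\text{ - }2$. For a permutation $\pi=\pi_1\cdots\pi_n$ define $e_1(\pi)=n$, $e_2(\pi)=\#\{i:\pi_i<\pi_{i+1}\}$ (the number of occurrences of the generalized pattern $12$, i.e. adjacent ascents), and for $k\ge 3$ let $e_k(\pi)$ be the number of occurrences of the generalized pattern $12\text{ - }3\text{ - }\cdots\text{ - }k$, i.e. the number of index tuples $(i,j_3,\dots,j_k)$ with $i+1<j_3<j_4<\cdots<j_k$ and $\pi_i<\pi_{i+1}<\pi_{j_3}<\cdots<\pi_{j_k}$. For $n\ge 0$ put $P_n=\prod_{k=0}^{n} x_{k+2}^{\binom{n}{k}}$, where $x_1,x_2,\dots$ are indeterminates. Then $$\sum_{\pi\in\mathcal{S}(132)}\prod_{k\ge1}x_k^{e_k(\pi)}=\cfrac{1}{1-x_1+x_1P_0-\cfrac{x_1P_0}{1-x_1+x_1P_1-\cfrac{x_1P_1}{1-x_1+x_1P_2-\cfrac{x_1P_2}{\ddots}}}},$$ so that the $(n+1)$st numerator is $x_1\prod_{k=0}^n x_{k+2}^{\binom nk}$.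
   Context: Identity of formal power series in the indeterminates $x_1,x_2,\dots$; a permutation avoids $1\text{ - }3\text{ - }2$ if it has no indices $a<b<c$ with $\pi_a<\pi_c<\pi_b$. -}

module Defs where

open import Data.Bool using (Bool; true; false; _∧_; _∨_; if_then_else_; not)
open import Data.Nat as ℕ using (ℕ; zero; suc; _∸_; _<ᵇ_; _≟_)
open import Data.Nat.Combinatorics using (_C_)
open import Data.Integer as ℤ using (ℤ; +_)
open import Data.List using (List; []; _∷_; map; concatMap; upTo; zipWith; foldr; length)
open import Data.Nat.ListAction using (sum)
open import Data.Bool.ListAction using (any)
open import Data.List.Properties using (≡-dec)
open import Relation.Nullary using (does)

-- Monomials in x₁, x₂, … : a monomial is an exponent list
-- [a₁, a₂, …, aₗ] standing for x₁^a₁ x₂^a₂ ⋯ xₗ^aₗ.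
-- Lists differing only by trailing zeros denote the same monomial;
-- `norm` strips trailing zeros (canonical form).

Monomial : Set
Monomial = List ℕ

cons0 : ℕ → List ℕ → List ℕ
cons0 zero [] = []
cons0 x ys = x ∷ ys

norm : Monomial → Monomial
norm [] = []
norm (x ∷ xs) = cons0 x (norm xs)

sameMon : Monomial → Monomial → Bool
sameMon μ ν = does (≡-dec _≟_ (norm μ) (norm ν))

isOne : Monomial → Bool
isOne μ = sameMon μ []

deg : Monomial → ℕ
deg = sum

divisors : Monomial → List Monomial
divisors [] = [] ∷ []
divisors (m ∷ ms) = concatMap (λ d → map (d ∷_) (divisors ms)) (upTo (suc m))

Series : Set
Series = Monomial → ℤ

sumℤ : List ℤ → ℤ
sumℤ = foldr ℤ._+_ (+ 0)

mon : Monomial → Series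
mon ν μ = if sameMon μ ν then + 1 else + 0

const : ℤ → Series
const c μ = if isOne μ then c else + 0

unitVec : ℕ → Monomial
unitVec zero = 1 ∷ []
unitVec (suc i) = 0 ∷ unitVec i

x : ℕ → Series
x i = mon (unitVec (i ∸ 1))

_⊕_ : Series → Series → Series
(f ⊕ g) μ = f μ ℤ.+ g μ

⊖_ : Series → Series
(⊖ f) μ = ℤ.- (f μ)

_⊝_ : Series → Series → Series
f ⊝ g = f ⊕ (⊖ g)

_⊛_ : Series → Series → Series
(f ⊛ g) μ = sumℤ (map (λ d → f d ℤ.* g (zipWith _∸_ μ d)) (divisors μ))

infixl 6 _⊕_ _⊝_
infixl 7 _⊛_

_^ₛ_ : Series → ℕ → Series
f ^ₛ zero = const (+ 1)
f ^ₛ suc k = f ⊛ (f ^ₛ k)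

-- Multiplicative inverse of a series f with constant term 1:
-- 1/f = Σ_{k≥0} (1 - f)^k ; since 1 - f has zero constant term, only
-- k ≤ deg μ contribute to the coefficient of μ.
inv : Series → Series
inv f μ = sumℤ (map (λ k → ((const (+ 1) ⊝ f) ^ₛ k) μ) (upTo (suc (deg μ))))

prodₛ : List Series → Series
prodₛ = foldr _⊛_ (const (+ 1))

P : ℕ → Series
P n = prodₛ (map (λ k → x (k ℕ.+ 2) ^ₛ (n C k)) (upTo (suc n)))

-- Convergents of the continued fraction.
-- cf m n is the depth-m truncation (tail replaced by 0) of
--   1/(1 - x₁ + x₁Pₙ - x₁Pₙ/(1 - x₁ + x₁Pₙ₊₁ - x₁Pₙ₊₁/(⋯)))
cf : ℕ → ℕ → Series
cf zero n = const (+ 0)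
cf (suc m) n =
  inv (const (+ 1) ⊝ x 1 ⊕ x 1 ⊛ P n ⊝ x 1 ⊛ P n ⊛ cf m (suc n))

-- Permutations (one-line notation as lists of distinct values).

insertions : ℕ → List ℕ → List (List ℕ)
insertions a [] = (a ∷ []) ∷ []
insertions a (y ∷ ys) = (a ∷ y ∷ ys) ∷ map (y ∷_) (insertions a ys)

perms : List ℕ → List (List ℕ)
perms [] = [] ∷ []
perms (a ∷ as) = concatMap (insertions a) (perms as)

Perms : ℕ → List (List ℕ)
Perms n = perms (upTo n)

has32above : ℕ → List ℕ → Bool
has32above v [] = false
has32above v (y ∷ zs) = any (λ z → (v <ᵇ z) ∧ (z <ᵇ y)) zs ∨ has32above v zs

contains132 : List ℕ → Bool
contains132 [] = false
contains132 (a ∷ rest) = has32above a rest ∨ contains132 rest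

avoids132 : List ℕ → Bool
avoids132 π = not (contains132 π)

chains : ℕ → ℕ → List ℕ → ℕ
chains zero v xs = 1
chains (suc t) v [] = 0
chains (suc t) v (y ∷ ys) =
  (if v <ᵇ y then chains t y ys else 0) ℕ.+ chains (suc t) v ys

occ : ℕ → List ℕ → ℕ
occ k (a ∷ b ∷ rest) =
  (if a <ᵇ b then chains (k ∸ 2) b rest else 0) ℕ.+ occ k (b ∷ rest)
occ k _ = 0

-- e_k(π) for k = 1,2,3,… ; e_k(π) = 0 for k > n = |π|, so the monomial
-- ∏_k x_k^{e_k(π)} is the exponent list [e₁, e₂, …, eₙ].
e : ℕ → List ℕ → ℕ
e zero π = 0
e (suc zero) π = length π
e (suc (suc j)) π = occ (suc (suc j)) π

weight : List ℕ → Monomial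
weight π = map (λ k → e (suc k) π) (upTo (length π))

countB : {A : Set} → (A → Bool) → List A → ℕ
countB p [] = 0
countB p (a ∷ as) = (if p a then 1 else 0) ℕ.+ countB p as

-- coefficient of μ in Σ_{π ∈ S(132)} ∏_k x_k^{e_k(π)}.
-- A permutation has x₁-exponent equal to its length, so only permutations
-- of length n = (x₁-exponent of μ) can contribute.
x1exp : Monomial → ℕ
x1exp [] = 0
x1exp (a ∷ _) = a

genS132 : Series
genS132 μ = + countB (λ π → avoids132 π ∧ sameMon (weight π) μ) (Perms (x1exp μ))

{-# OPTIONS --safe #-}
module Submission where

-- A nonempty 1-3-2-avoider factors uniquely as α n β with n its maximum and every
-- entry of α above every entry of β; iterating on β cuts it into first-return
-- blocks, each a single point or a nonempty avoider α followed by its maximum.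
-- Under this factorisation the numbers of occurrences of 12-3-⋯-k transform as
-- e(α n β) = e(β) + δ + (1 + shift) e(α), so a nonempty avoider nested at depth n
-- contributes ∏ₖ x_{k+2}^{C(n,k)} = Pₙ besides its own statistics. Hence the
-- generating functions Fₙ of avoiders at depth n satisfy
-- Fₙ = 1/(1 − x₁ − x₁Pₙ(Fₙ₊₁ − 1)), which unfolds into the continued fraction.
-- Avoiders are enumerated as binary trees (left subtree α, right subtree β), and
-- the coefficient of a monomial of x₁-degree L depends only on the first L + 1
-- levels of the fraction.

open import Defs
open import Algebra.Properties.CommutativeSemigroup using (interchange)
open import Data.Bool using (Bool; true; false; _∧_; _∨_; if_then_else_; not; T)
open import Data.Bool.ListAction using (any)
import Data.Bool.Properties as BoolP
open import Data.Empty using (⊥; ⊥-elim)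
open import Data.Integer as ℤ using (ℤ; +_)
import Data.Integer.Properties as ℤP
import Data.Integer.Solver as ℤSolver
open import Data.List using (List; []; _∷_; map; concat; concatMap; upTo; downFrom; zipWith; foldr; length; _++_; applyUpTo; take; drop)
import Data.List.Properties as LP
open import Data.List.Membership.Propositional using (_∈_; _∉_; find; lose)
open import Data.List.Membership.Propositional.Properties using (∈-concatMap⁻; ∈-concatMap⁺; ∈-upTo⁻; ∈-upTo⁺; ∈-map⁻; ∈-map⁺; ∈-++⁻; ∈-++⁺ˡ; ∈-++⁺ʳ; ∈-∃++)
open import Data.List.Relation.Binary.Permutation.Propositional as ↭ using (_↭_; ↭⇒↭ₛ)
import Data.List.Relation.Binary.Permutation.Setoid.Properties as ↭ₛP
import Data.List.Relation.Binary.Permutation.Propositional.Properties as ↭P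
open import Data.List.Relation.Unary.All as All using (All; []; _∷_)
import Data.List.Relation.Unary.All.Properties as AllP
open import Data.List.Relation.Unary.AllPairs as AP using (AllPairs; []; _∷_)
import Data.List.Relation.Unary.AllPairs.Properties as APP
open import Data.List.Relation.Unary.Any using (here; there)
open import Data.List.Relation.Unary.Unique.Propositional using (Unique)
import Data.List.Relation.Unary.Unique.Propositional.Properties as UP
open import Data.Nat using (ℕ; zero; suc; _∸_; _<ᵇ_; _≟_; _+_; _*_; _≤_; _<_; z≤n; s≤s; _≤ᵇ_; _≡ᵇ_)
open import Data.Nat.Combinatorics using (_C_; nCk+nC[k+1]≡[n+1]C[k+1]; k>n⇒nCk≡0)
open import Data.Nat.Properties
open import Data.Nat.Solver using (module +-*-Solver)
open import Data.Product using (_×_; _,_; proj₁; proj₂; ∃)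
open import Data.Sum using (_⊎_; inj₁; inj₂)
open import Data.Unit using (tt)
open import Relation.Binary.Definitions using (tri<; tri≈; tri>)
open import Relation.Binary.PropositionalEquality
open import Relation.Nullary using (yes; no; ¬_)

⟦_⟧ : Bool → ℕ
⟦ true ⟧ = 1
⟦ false ⟧ = 0

if-⟦⟧ : ∀ b → (if b then 1 else 0) ≡ ⟦ b ⟧
if-⟦⟧ true = refl
if-⟦⟧ false = refl

⟦⟧-∧ : (a b : Bool) → ⟦ a ∧ b ⟧ ≡ ⟦ a ⟧ * ⟦ b ⟧
⟦⟧-∧ true b = sym (+-identityʳ ⟦ b ⟧)
⟦⟧-∧ false b = refl

T⇒≡true : {b : Bool} → T b → b ≡ true
T⇒≡true {true} _ = refl

≡true⇒T : {b : Bool} → b ≡ true → T b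
≡true⇒T refl = tt

Bool-ext : {b c : Bool} → (b ≡ true → c ≡ true) → (c ≡ true → b ≡ true) → b ≡ c
Bool-ext {true} {true} f g = refl
Bool-ext {true} {false} f g = sym (f refl)
Bool-ext {false} {true} f g = g refl
Bool-ext {false} {false} f g = refl

∧-intro : {a b : Bool} → a ≡ true → b ≡ true → a ∧ b ≡ true
∧-intro refl refl = refl

∧-elimˡ : {a b : Bool} → a ∧ b ≡ true → a ≡ true
∧-elimˡ {true} _ = refl

∧-elimʳ : {a b : Bool} → a ∧ b ≡ true → b ≡ true
∧-elimʳ {true} e = e

≤ᵇ≡true⇒≤ : {m n : ℕ} → (m ≤ᵇ n) ≡ true → m ≤ n
≤ᵇ≡true⇒≤ {m} {n} e = ≤ᵇ⇒≤ m n (≡true⇒T e)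

≤⇒≤ᵇ≡true : {m n : ℕ} → m ≤ n → (m ≤ᵇ n) ≡ true
≤⇒≤ᵇ≡true le = T⇒≡true (≤⇒≤ᵇ le)

≡ᵇ≡true⇒≡ : {m n : ℕ} → (m ≡ᵇ n) ≡ true → m ≡ n
≡ᵇ≡true⇒≡ {m} {n} e = ≡ᵇ⇒≡ m n (≡true⇒T e)

≡⇒≡ᵇ≡true : {m n : ℕ} → m ≡ n → (m ≡ᵇ n) ≡ true
≡⇒≡ᵇ≡true {m} {n} e = T⇒≡true (≡⇒≡ᵇ m n e)

<ᵇ-suc : ∀ x m → (x <ᵇ suc m) ≡ (x ≤ᵇ m)
<ᵇ-suc zero m = refl
<ᵇ-suc (suc x) m = refl

∈-concatMap⁻′ : ∀ {A B : Set} (g : A → List B) xs {y} → y ∈ concatMap g xs → ∃ λ x → x ∈ xs × y ∈ g x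
∈-concatMap⁻′ g xs m = find (∈-concatMap⁻ g m)

∈-concatMap⁺′ : ∀ {A B : Set} (g : A → List B) {xs x y} → x ∈ xs → y ∈ g x → y ∈ concatMap g xs
∈-concatMap⁺′ g mx my = ∈-concatMap⁺ g (lose mx my)

+-interchange : (a b c d : ℕ) → (a + b) + (c + d) ≡ (a + c) + (b + d)
+-interchange = interchange +-commutativeSemigroup

sumL : {A : Set} → (A → ℕ) → List A → ℕ
sumL f [] = 0
sumL f (x ∷ xs) = f x + sumL f xs

countB≡sumL : {A : Set} (p : A → Bool) (xs : List A) → countB p xs ≡ sumL (λ x → ⟦ p x ⟧) xs
countB≡sumL p [] = refl
countB≡sumL p (x ∷ xs) = cong₂ _+_ (if-⟦⟧ (p x)) (countB≡sumL p xs)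

sumL-++ : {A : Set} (f : A → ℕ) (xs ys : List A) → sumL f (xs ++ ys) ≡ sumL f xs + sumL f ys
sumL-++ f [] ys = refl
sumL-++ f (x ∷ xs) ys = trans (cong (_+_ (f x)) (sumL-++ f xs ys)) (sym (+-assoc (f x) _ _))

sumL-concatMap : {A B : Set} (f : B → ℕ) (g : A → List B) (xs : List A) →
  sumL f (concatMap g xs) ≡ sumL (λ x → sumL f (g x)) xs
sumL-concatMap f g [] = refl
sumL-concatMap f g (x ∷ xs) =
  trans (sumL-++ f (g x) (concatMap g xs)) (cong (_+_ (sumL f (g x))) (sumL-concatMap f g xs))

sumL-map : {A B : Set} (f : B → ℕ) (g : A → B) (xs : List A) → sumL f (map g xs) ≡ sumL (λ x → f (g x)) xs
sumL-map f g [] = refl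
sumL-map f g (x ∷ xs) = cong (_+_ (f (g x))) (sumL-map f g xs)

sumL-cong : {A : Set} {f g : A → ℕ} (xs : List A) → (∀ x → f x ≡ g x) → sumL f xs ≡ sumL g xs
sumL-cong [] h = refl
sumL-cong (x ∷ xs) h = cong₂ _+_ (h x) (sumL-cong xs h)

sumL-zero : {A : Set} {f : A → ℕ} (xs : List A) → (∀ x → x ∈ xs → f x ≡ 0) → sumL f xs ≡ 0
sumL-zero [] h = refl
sumL-zero (x ∷ xs) h = cong₂ _+_ (h x (here refl)) (sumL-zero xs (λ y m → h y (there m)))

sumL-*ˡ : {A : Set} (c : ℕ) (f : A → ℕ) (xs : List A) → sumL (λ x → c * f x) xs ≡ c * sumL f xs
sumL-*ˡ c f [] = sym (*-zeroʳ c)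
sumL-*ˡ c f (x ∷ xs) = trans (cong (_+_ (c * f x)) (sumL-*ˡ c f xs)) (sym (*-distribˡ-+ c (f x) _))

sumL-*ʳ : {A : Set} (c : ℕ) (f : A → ℕ) (xs : List A) → sumL (λ x → f x * c) xs ≡ sumL f xs * c
sumL-*ʳ c f xs = trans (sumL-cong xs (λ x → *-comm (f x) c)) (trans (sumL-*ˡ c f xs) (*-comm c _))

sumL-+ : {A : Set} (f g : A → ℕ) (xs : List A) → sumL (λ x → f x + g x) xs ≡ sumL f xs + sumL g xs
sumL-+ f g [] = refl
sumL-+ f g (x ∷ xs) = trans (cong (_+_ (f x + g x)) (sumL-+ f g xs)) (+-interchange (f x) (g x) _ _)

sumL-swap : {A B : Set} (f : A → B → ℕ) (xs : List A) (ys : List B) →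
  sumL (λ x → sumL (λ y → f x y) ys) xs ≡ sumL (λ y → sumL (λ x → f x y) xs) ys
sumL-swap f [] ys = sym (sumL-zero ys (λ _ _ → refl))
sumL-swap f (x ∷ xs) ys =
  trans (cong (_+_ (sumL (λ y → f x y) ys)) (sumL-swap f xs ys))
        (sym (sumL-+ (λ y → f x y) (λ y → sumL (λ x → f x y) xs) ys))

sumL-upTo-suc : (n : ℕ) (f : ℕ → ℕ) → sumL f (upTo (suc n)) ≡ f 0 + sumL (λ i → f (suc i)) (upTo n)
sumL-upTo-suc n f = cong (_+_ (f 0)) (trans (cong (sumL f) (sym (LP.map-upTo suc n))) (sumL-map f suc (upTo n)))

sumL-upTo-∷ʳ : (n : ℕ) (f : ℕ → ℕ) → sumL f (upTo (suc n)) ≡ sumL f (upTo n) + f n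
sumL-upTo-∷ʳ n f =
  trans (cong (sumL f) (sym (LP.upTo-∷ʳ n)))
        (trans (sumL-++ f (upTo n) (n ∷ [])) (cong (_+_ (sumL f (upTo n))) (+-identityʳ (f n))))

sumL-upTo-extend : (f : ℕ → ℕ) (L D : ℕ) → L ≤ D → (∀ k → L < k → f k ≡ 0) →
  sumL f (upTo (suc D)) ≡ sumL f (upTo (suc L))
sumL-upTo-extend f L zero z≤n h = refl
sumL-upTo-extend f L (suc D) le h with m≤n⇒m<n∨m≡n le
... | inj₁ lt =
  trans (sumL-upTo-∷ʳ (suc D) f)
        (trans (cong₂ _+_ (sumL-upTo-extend f L D (≤-pred lt) h) (h (suc D) lt)) (+-identityʳ _))
... | inj₂ refl = refl

sumL-upTo-δ : (n c : ℕ) (f : ℕ → ℕ) → sumL (λ i → ⟦ i ≡ᵇ c ⟧ * f i) (upTo n) ≡ ⟦ c <ᵇ n ⟧ * f c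
sumL-upTo-δ zero c f = refl
sumL-upTo-δ (suc n) zero f =
  trans (sumL-upTo-suc n (λ i → ⟦ i ≡ᵇ 0 ⟧ * f i))
        (trans (cong (_+_ (1 * f 0)) (sumL-zero (upTo n) (λ _ _ → refl))) (+-identityʳ _))
sumL-upTo-δ (suc n) (suc c) f =
  trans (sumL-upTo-suc n (λ i → ⟦ i ≡ᵇ suc c ⟧ * f i)) (sumL-upTo-δ n c (λ i → f (suc i)))

exponent : Monomial → ℕ → ℕ
exponent [] j = 0
exponent (a ∷ μ) zero = a
exponent (a ∷ μ) (suc j) = exponent μ j

tailₘ : Monomial → Monomial
tailₘ [] = []
tailₘ (a ∷ μ) = μ

exponent-0 : ∀ μ → exponent μ 0 ≡ x1exp μ
exponent-0 [] = refl
exponent-0 (a ∷ μ) = refl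

exponent-suc : ∀ μ j → exponent μ (suc j) ≡ exponent (tailₘ μ) j
exponent-suc [] j = refl
exponent-suc (a ∷ μ) j = refl

record _≈ₘ_ (μ ν : Monomial) : Set where
  constructor mk≈
  field at : ∀ j → exponent μ j ≡ exponent ν j
open _≈ₘ_ public
infix 4 _≈ₘ_

≈ₘ-refl : ∀ {μ} → μ ≈ₘ μ
≈ₘ-refl = mk≈ λ j → refl

≈ₘ-sym : ∀ {μ ν} → μ ≈ₘ ν → ν ≈ₘ μ
≈ₘ-sym h = mk≈ λ j → sym (at h j)

≈ₘ-trans : ∀ {μ ν ρ} → μ ≈ₘ ν → ν ≈ₘ ρ → μ ≈ₘ ρ
≈ₘ-trans h g = mk≈ λ j → trans (at h j) (at g j)

≈ₘ-x1exp∷tailₘ : ∀ μ → μ ≈ₘ (x1exp μ ∷ tailₘ μ)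
≈ₘ-x1exp∷tailₘ [] = mk≈ λ { zero → refl ; (suc j) → refl }
≈ₘ-x1exp∷tailₘ (a ∷ μ) = ≈ₘ-refl

x1exp-resp : ∀ {μ ν} → μ ≈ₘ ν → x1exp μ ≡ x1exp ν
x1exp-resp {μ} {ν} h = trans (sym (exponent-0 μ)) (trans (at h 0) (exponent-0 ν))

tailₘ-resp : ∀ {μ ν} → μ ≈ₘ ν → tailₘ μ ≈ₘ tailₘ ν
tailₘ-resp {μ} {ν} h = mk≈ λ j → trans (sym (exponent-suc μ j)) (trans (at h (suc j)) (exponent-suc ν j))

exponent-cons0 : ∀ a μ j → exponent (cons0 a μ) j ≡ exponent (a ∷ μ) j
exponent-cons0 zero [] zero = refl
exponent-cons0 zero [] (suc j) = refl
exponent-cons0 zero (b ∷ μ) j = refl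
exponent-cons0 (suc a) μ j = refl

exponent-norm : ∀ μ j → exponent (norm μ) j ≡ exponent μ j
exponent-norm [] j = refl
exponent-norm (a ∷ μ) zero = exponent-cons0 a (norm μ) zero
exponent-norm (a ∷ μ) (suc j) = trans (exponent-cons0 a (norm μ) (suc j)) (exponent-norm μ j)

≈ₘ⇒norm≡ : ∀ μ ν → μ ≈ₘ ν → norm μ ≡ norm ν
≈ₘ⇒norm≡ [] [] h = refl
≈ₘ⇒norm≡ [] (b ∷ ν) h with at h 0
... | refl = cong (cons0 0) (≈ₘ⇒norm≡ [] ν (tailₘ-resp h))
≈ₘ⇒norm≡ (a ∷ μ) [] h with at h 0
... | refl = cong (cons0 0) (≈ₘ⇒norm≡ μ [] (tailₘ-resp h))
≈ₘ⇒norm≡ (a ∷ μ) (b ∷ ν) h = cong₂ cons0 (at h 0) (≈ₘ⇒norm≡ μ ν (tailₘ-resp h))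

sameMon⇒≈ₘ : ∀ μ ν → sameMon μ ν ≡ true → μ ≈ₘ ν
sameMon⇒≈ₘ μ ν e with LP.≡-dec _≟_ (norm μ) (norm ν)
... | yes eq = mk≈ λ j → trans (sym (exponent-norm μ j)) (trans (cong (λ ρ → exponent ρ j) eq) (exponent-norm ν j))

≈ₘ⇒sameMon : ∀ μ ν → μ ≈ₘ ν → sameMon μ ν ≡ true
≈ₘ⇒sameMon μ ν h with LP.≡-dec _≟_ (norm μ) (norm ν)
... | yes _ = refl
... | no ne = ⊥-elim (ne (≈ₘ⇒norm≡ μ ν h))

sameMon-resp : ∀ μ μ′ ν ν′ → μ ≈ₘ μ′ → ν ≈ₘ ν′ → sameMon μ ν ≡ sameMon μ′ ν′
sameMon-resp μ μ′ ν ν′ hμ hν = Bool-ext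
  (λ e → ≈ₘ⇒sameMon μ′ ν′ (≈ₘ-trans (≈ₘ-sym hμ) (≈ₘ-trans (sameMon⇒≈ₘ μ ν e) hν)))
  (λ e → ≈ₘ⇒sameMon μ ν (≈ₘ-trans hμ (≈ₘ-trans (sameMon⇒≈ₘ μ′ ν′ e) (≈ₘ-sym hν))))

sameMon-sym : ∀ μ ν → sameMon μ ν ≡ sameMon ν μ
sameMon-sym μ ν = Bool-ext
  (λ e → ≈ₘ⇒sameMon ν μ (≈ₘ-sym (sameMon⇒≈ₘ μ ν e)))
  (λ e → ≈ₘ⇒sameMon μ ν (≈ₘ-sym (sameMon⇒≈ₘ ν μ e)))

sameMon-cons : ∀ i μ ν → sameMon (i ∷ μ) ν ≡ (i ≡ᵇ x1exp ν) ∧ sameMon μ (tailₘ ν)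
sameMon-cons i μ ν = Bool-ext to from
  where
  to : sameMon (i ∷ μ) ν ≡ true → (i ≡ᵇ x1exp ν) ∧ sameMon μ (tailₘ ν) ≡ true
  to e = ∧-intro (≡⇒≡ᵇ≡true (x1exp-resp h)) (≈ₘ⇒sameMon μ (tailₘ ν) (tailₘ-resp h))
    where h = sameMon⇒≈ₘ (i ∷ μ) ν e
  from : (i ≡ᵇ x1exp ν) ∧ sameMon μ (tailₘ ν) ≡ true → sameMon (i ∷ μ) ν ≡ true
  from e = ≈ₘ⇒sameMon (i ∷ μ) ν (≈ₘ-trans h (≈ₘ-sym (≈ₘ-x1exp∷tailₘ ν)))
    where
    h : (i ∷ μ) ≈ₘ (x1exp ν ∷ tailₘ ν)
    h = mk≈ λ { zero → ≡ᵇ≡true⇒≡ (∧-elimˡ e) ; (suc j) → at (sameMon⇒≈ₘ μ (tailₘ ν) (∧-elimʳ e)) j }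

sameMon-[] : ∀ ν → sameMon ν [] ≡ (x1exp ν ≡ᵇ 0) ∧ sameMon (tailₘ ν) []
sameMon-[] ν =
  trans (sameMon-resp ν (x1exp ν ∷ tailₘ ν) [] (0 ∷ []) (≈ₘ-x1exp∷tailₘ ν) (mk≈ λ { zero → refl ; (suc j) → refl }))
        (sameMon-cons (x1exp ν) (tailₘ ν) (0 ∷ []))

_+ₘ_ : Monomial → Monomial → Monomial
[] +ₘ ν = ν
(a ∷ μ) +ₘ [] = a ∷ μ
(a ∷ μ) +ₘ (b ∷ ν) = (a + b) ∷ (μ +ₘ ν)
infixl 6 _+ₘ_

exponent-+ₘ : ∀ μ ν j → exponent (μ +ₘ ν) j ≡ exponent μ j + exponent ν j
exponent-+ₘ [] ν j = refl
exponent-+ₘ (a ∷ μ) [] j = sym (+-identityʳ _)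
exponent-+ₘ (a ∷ μ) (b ∷ ν) zero = refl
exponent-+ₘ (a ∷ μ) (b ∷ ν) (suc j) = exponent-+ₘ μ ν j

_∸ₘ_ : Monomial → Monomial → Monomial
[] ∸ₘ ν = []
(a ∷ μ) ∸ₘ [] = a ∷ μ
(a ∷ μ) ∸ₘ (b ∷ ν) = (a ∸ b) ∷ (μ ∸ₘ ν)

exponent-∸ₘ : ∀ μ ν j → exponent (μ ∸ₘ ν) j ≡ exponent μ j ∸ exponent ν j
exponent-∸ₘ [] ν j = sym (0∸n≡0 (exponent ν j))
exponent-∸ₘ (a ∷ μ) [] j = refl
exponent-∸ₘ (a ∷ μ) (b ∷ ν) zero = refl
exponent-∸ₘ (a ∷ μ) (b ∷ ν) (suc j) = exponent-∸ₘ μ ν j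

∸ₘ-resp : ∀ {μ μ′ ν ν′} → μ ≈ₘ μ′ → ν ≈ₘ ν′ → (μ ∸ₘ ν) ≈ₘ (μ′ ∸ₘ ν′)
∸ₘ-resp {μ} {μ′} {ν} {ν′} hμ hν =
  mk≈ λ j → trans (exponent-∸ₘ μ ν j) (trans (cong₂ _∸_ (at hμ j) (at hν j)) (sym (exponent-∸ₘ μ′ ν′ j)))

divides : Monomial → Monomial → Bool
divides [] _ = true
divides (a ∷ μ) [] = (a ≡ᵇ 0) ∧ divides μ []
divides (a ∷ μ) (b ∷ ν) = (a ≤ᵇ b) ∧ divides μ ν

divides⇒≤ : ∀ μ ν → divides μ ν ≡ true → ∀ j → exponent μ j ≤ exponent ν j
divides⇒≤ [] ν e j = z≤n
divides⇒≤ (a ∷ μ) [] e zero = ≤-reflexive (≡ᵇ≡true⇒≡ (∧-elimˡ e))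
divides⇒≤ (a ∷ μ) [] e (suc j) = divides⇒≤ μ [] (∧-elimʳ e) j
divides⇒≤ (a ∷ μ) (b ∷ ν) e zero = ≤ᵇ≡true⇒≤ (∧-elimˡ e)
divides⇒≤ (a ∷ μ) (b ∷ ν) e (suc j) = divides⇒≤ μ ν (∧-elimʳ e) j

≤⇒divides : ∀ μ ν → (∀ j → exponent μ j ≤ exponent ν j) → divides μ ν ≡ true
≤⇒divides [] ν h = refl
≤⇒divides (a ∷ μ) [] h = ∧-intro (≡⇒≡ᵇ≡true (n≤0⇒n≡0 (h 0))) (≤⇒divides μ [] (λ j → h (suc j)))
≤⇒divides (a ∷ μ) (b ∷ ν) h = ∧-intro (≤⇒≤ᵇ≡true (h 0)) (≤⇒divides μ ν (λ j → h (suc j)))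

divides-x1exp∷tailₘ : ∀ ν μ → divides ν μ ≡ (x1exp ν ≤ᵇ x1exp μ) ∧ divides (tailₘ ν) (tailₘ μ)
divides-x1exp∷tailₘ ν μ = Bool-ext to from
  where
  to : divides ν μ ≡ true → (x1exp ν ≤ᵇ x1exp μ) ∧ divides (tailₘ ν) (tailₘ μ) ≡ true
  to e = ∧-intro (≤⇒≤ᵇ≡true (subst₂ _≤_ (exponent-0 ν) (exponent-0 μ) (h 0)))
                 (≤⇒divides (tailₘ ν) (tailₘ μ) (λ j → subst₂ _≤_ (exponent-suc ν j) (exponent-suc μ j) (h (suc j))))
    where h = divides⇒≤ ν μ e
  from : (x1exp ν ≤ᵇ x1exp μ) ∧ divides (tailₘ ν) (tailₘ μ) ≡ true → divides ν μ ≡ true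
  from e = ≤⇒divides ν μ λ
    { zero → subst₂ _≤_ (sym (exponent-0 ν)) (sym (exponent-0 μ)) (≤ᵇ≡true⇒≤ (∧-elimˡ e))
    ; (suc j) → subst₂ _≤_ (sym (exponent-suc ν j)) (sym (exponent-suc μ j)) (divides⇒≤ (tailₘ ν) (tailₘ μ) (∧-elimʳ e) j) }

sameMon-+ₘˡ : ∀ ν ρ μ → sameMon (ν +ₘ ρ) μ ≡ divides ν μ ∧ sameMon ρ (μ ∸ₘ ν)
sameMon-+ₘˡ ν ρ μ = Bool-ext to from
  where
  to : sameMon (ν +ₘ ρ) μ ≡ true → divides ν μ ∧ sameMon ρ (μ ∸ₘ ν) ≡ true
  to e = ∧-intro (≤⇒divides ν μ (λ j → subst (exponent ν j ≤_) (sum≡ j) (m≤m+n (exponent ν j) (exponent ρ j))))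
                 (≈ₘ⇒sameMon ρ (μ ∸ₘ ν) (mk≈ λ j → begin
                   exponent ρ j                          ≡⟨ sym (m+n∸m≡n (exponent ν j) (exponent ρ j)) ⟩
                   exponent ν j + exponent ρ j ∸ exponent ν j ≡⟨ cong (_∸ exponent ν j) (sum≡ j) ⟩
                   exponent μ j ∸ exponent ν j           ≡⟨ sym (exponent-∸ₘ μ ν j) ⟩
                   exponent (μ ∸ₘ ν) j                   ∎))
    where
    open ≡-Reasoning
    sum≡ : ∀ j → exponent ν j + exponent ρ j ≡ exponent μ j
    sum≡ j = trans (sym (exponent-+ₘ ν ρ j)) (at (sameMon⇒≈ₘ (ν +ₘ ρ) μ e) j)
  from : divides ν μ ∧ sameMon ρ (μ ∸ₘ ν) ≡ true → sameMon (ν +ₘ ρ) μ ≡ true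
  from e = ≈ₘ⇒sameMon (ν +ₘ ρ) μ (mk≈ λ j → begin
    exponent (ν +ₘ ρ) j                        ≡⟨ exponent-+ₘ ν ρ j ⟩
    exponent ν j + exponent ρ j                ≡⟨ cong (_+_ (exponent ν j)) (at ρ≈ j) ⟩
    exponent ν j + exponent (μ ∸ₘ ν) j         ≡⟨ cong (_+_ (exponent ν j)) (exponent-∸ₘ μ ν j) ⟩
    exponent ν j + (exponent μ j ∸ exponent ν j) ≡⟨ m+[n∸m]≡n (divides⇒≤ ν μ (∧-elimˡ e) j) ⟩
    exponent μ j                               ∎)
    where
    open ≡-Reasoning
    ρ≈ = sameMon⇒≈ₘ ρ (μ ∸ₘ ν) (∧-elimʳ e)

divisor-cofactor : ∀ μ d → d ∈ divisors μ → (zipWith _∸_ μ d ≈ₘ μ ∸ₘ d) × (x1exp d ≤ x1exp μ)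
divisor-cofactor [] d (here refl) = ≈ₘ-refl , z≤n
divisor-cofactor (m ∷ μ) d mem with ∈-concatMap⁻′ (λ i → map (i ∷_) (divisors μ)) (upTo (suc m)) mem
... | i , mi , m′ with ∈-map⁻ (i ∷_) m′
... | d′ , md′ , refl =
  mk≈ (λ { zero → refl ; (suc j) → at (proj₁ (divisor-cofactor μ d′ md′)) j }) , ≤-pred (∈-upTo⁻ mi)

x1exp-cofactor : ∀ μ d → d ∈ divisors μ → x1exp (zipWith _∸_ μ d) ≡ x1exp μ ∸ x1exp d
x1exp-cofactor μ d m = begin
  x1exp (zipWith _∸_ μ d)   ≡⟨ sym (exponent-0 (zipWith _∸_ μ d)) ⟩
  exponent (zipWith _∸_ μ d) 0 ≡⟨ at (proj₁ (divisor-cofactor μ d m)) 0 ⟩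
  exponent (μ ∸ₘ d) 0       ≡⟨ exponent-∸ₘ μ d 0 ⟩
  exponent μ 0 ∸ exponent d 0 ≡⟨ cong₂ _∸_ (exponent-0 μ) (exponent-0 d) ⟩
  x1exp μ ∸ x1exp d         ∎
  where open ≡-Reasoning

x1exp-cofactor-≤ : ∀ μ d → d ∈ divisors μ → x1exp (zipWith _∸_ μ d) ≤ x1exp μ
x1exp-cofactor-≤ μ d m = subst (_≤ x1exp μ) (sym (x1exp-cofactor μ d m)) (m∸n≤m (x1exp μ) (x1exp d))


sumℤ-cong : {A : Set} {f g : A → ℤ} (xs : List A) → (∀ x → x ∈ xs → f x ≡ g x) → sumℤ (map f xs) ≡ sumℤ (map g xs)
sumℤ-cong [] h = refl
sumℤ-cong (x ∷ xs) h = cong₂ ℤ._+_ (h x (here refl)) (sumℤ-cong xs (λ y m → h y (there m)))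

sumℤ-pos : {A : Set} (f : A → ℕ) (xs : List A) → sumℤ (map (λ x → + f x) xs) ≡ + sumL f xs
sumℤ-pos f [] = refl
sumℤ-pos f (x ∷ xs) = cong (ℤ._+_ (+ f x)) (sumℤ-pos f xs)

sumℤ-indicator : {A : Set} (p : A → Bool) (F : A → ℤ) (c : ℤ) (xs : List A) →
  (∀ x → x ∈ xs → p x ≡ true → F x ≡ c) →
  sumℤ (map (λ x → (if p x then + 1 else + 0) ℤ.* F x) xs) ≡ + countB p xs ℤ.* c
sumℤ-indicator p F c [] h = sym (ℤP.*-zeroˡ c)
sumℤ-indicator p F c (x ∷ xs) h with p x in e
... | true = begin
  + 1 ℤ.* F x ℤ.+ rest                ≡⟨ cong₂ ℤ._+_ (trans (ℤP.*-identityˡ (F x)) (h x (here refl) e)) IH ⟩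
  c ℤ.+ + countB p xs ℤ.* c           ≡⟨ cong (ℤ._+ (+ countB p xs ℤ.* c)) (sym (ℤP.*-identityˡ c)) ⟩
  + 1 ℤ.* c ℤ.+ + countB p xs ℤ.* c   ≡⟨ sym (ℤP.*-distribʳ-+ c (+ 1) (+ countB p xs)) ⟩
  + (1 + countB p xs) ℤ.* c           ∎
  where
  open ≡-Reasoning
  rest = sumℤ (map (λ x → (if p x then + 1 else + 0) ℤ.* F x) xs)
  IH = sumℤ-indicator p F c xs (λ y m → h y (there m))
... | false =
  trans (cong (ℤ._+ sumℤ (map (λ x → (if p x then + 1 else + 0) ℤ.* F x) xs)) (ℤP.*-zeroˡ (F x)))
        (trans (ℤP.+-identityˡ _) (sumℤ-indicator p F c xs (λ y m → h y (there m))))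

sumL-indicator : {A : Set} (p : A → Bool) (F : A → ℕ) (c : ℕ) (xs : List A) →
  (∀ x → x ∈ xs → p x ≡ true → F x ≡ c) → sumL (λ x → ⟦ p x ⟧ * F x) xs ≡ countB p xs * c
sumL-indicator p F c [] h = refl
sumL-indicator p F c (x ∷ xs) h with p x in e
... | true = cong₂ _+_ (trans (+-identityʳ (F x)) (h x (here refl) e)) (sumL-indicator p F c xs (λ y m → h y (there m)))
... | false = sumL-indicator p F c xs (λ y m → h y (there m))

⊛-cong : ∀ {f f′ g g′} → f ≗ f′ → g ≗ g′ → (f ⊛ g) ≗ (f′ ⊛ g′)
⊛-cong hf hg μ = sumℤ-cong (divisors μ) (λ d _ → cong₂ ℤ._*_ (hf d) (hg _))

⊛-cong-local : ∀ f f′ g g′ μ →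
  (∀ d → d ∈ divisors μ → (f d ≡ f′ d) × (g (zipWith _∸_ μ d) ≡ g′ (zipWith _∸_ μ d))) →
  (f ⊛ g) μ ≡ (f′ ⊛ g′) μ
⊛-cong-local f f′ g g′ μ h = sumℤ-cong (divisors μ) (λ d m → cong₂ ℤ._*_ (proj₁ (h d m)) (proj₂ (h d m)))

⊛-congʳ-local : ∀ f g g′ μ →
  (∀ d → d ∈ divisors μ → (f d ≡ + 0) ⊎ (g (zipWith _∸_ μ d) ≡ g′ (zipWith _∸_ μ d))) →
  (f ⊛ g) μ ≡ (f ⊛ g′) μ
⊛-congʳ-local f g g′ μ h = sumℤ-cong (divisors μ) (λ d m → term d (h d m))
  where
  term : ∀ d → (f d ≡ + 0) ⊎ (g (zipWith _∸_ μ d) ≡ g′ (zipWith _∸_ μ d)) →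
         f d ℤ.* g (zipWith _∸_ μ d) ≡ f d ℤ.* g′ (zipWith _∸_ μ d)
  term d (inj₁ f≡0) rewrite f≡0 = refl
  term d (inj₂ g≡g′) = cong (f d ℤ.*_) g≡g′

Respects≈ₘ : Series → Set
Respects≈ₘ f = ∀ μ ν → μ ≈ₘ ν → f μ ≡ f ν

ℤ⟦_⟧ : Bool → ℤ
ℤ⟦ b ⟧ = if b then + 1 else + 0

mon-resp : ∀ ν → Respects≈ₘ (mon ν)
mon-resp ν μ μ′ h = cong ℤ⟦_⟧ (sameMon-resp μ μ′ ν ν h ≈ₘ-refl)

mon-cong : ∀ ν ν′ → ν ≈ₘ ν′ → mon ν ≗ mon ν′
mon-cong ν ν′ h μ = cong ℤ⟦_⟧ (sameMon-resp μ μ ν ν′ ≈ₘ-refl h)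

mon-∷ : ∀ i ρ ν → mon (i ∷ ρ) ν ≡ ℤ⟦ (i ≡ᵇ x1exp ν) ∧ sameMon ρ (tailₘ ν) ⟧
mon-∷ i ρ ν = cong ℤ⟦_⟧ (trans (sameMon-sym ν (i ∷ ρ)) (sameMon-cons i ρ ν))

divisors-count : ∀ μ ν → countB (λ d → sameMon d ν) (divisors μ) ≡ ⟦ divides ν μ ⟧
divisors-count [] ν = trans (+-identityʳ _) (trans (if-⟦⟧ (sameMon [] ν)) (cong ⟦_⟧ (Bool-ext
   (λ e → ≤⇒divides ν [] (λ j → ≤-reflexive (sym (at (sameMon⇒≈ₘ [] ν e) j))))
   (λ e → ≈ₘ⇒sameMon [] ν (mk≈ λ j → sym (n≤0⇒n≡0 (divides⇒≤ ν [] e j)))))))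
divisors-count (m ∷ μ) ν = begin
  countB (λ d → sameMon d ν) (concatMap (λ i → map (i ∷_) (divisors μ)) (upTo (suc m)))
    ≡⟨ countB≡sumL _ (concatMap (λ i → map (i ∷_) (divisors μ)) (upTo (suc m))) ⟩
  sumL (λ d → ⟦ sameMon d ν ⟧) (concatMap (λ i → map (i ∷_) (divisors μ)) (upTo (suc m)))
    ≡⟨ sumL-concatMap (λ d → ⟦ sameMon d ν ⟧) (λ i → map (i ∷_) (divisors μ)) (upTo (suc m)) ⟩
  sumL (λ i → sumL (λ d → ⟦ sameMon d ν ⟧) (map (i ∷_) (divisors μ))) (upTo (suc m))
    ≡⟨ sumL-cong (upTo (suc m)) (λ i → trans (sumL-map (λ d → ⟦ sameMon d ν ⟧) (i ∷_) (divisors μ)) (column i)) ⟩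
  sumL (λ i → ⟦ i ≡ᵇ x1exp ν ⟧ * ⟦ divides (tailₘ ν) μ ⟧) (upTo (suc m))
    ≡⟨ sumL-upTo-δ (suc m) (x1exp ν) (λ _ → ⟦ divides (tailₘ ν) μ ⟧) ⟩
  ⟦ x1exp ν <ᵇ suc m ⟧ * ⟦ divides (tailₘ ν) μ ⟧
    ≡⟨ cong (λ b → ⟦ b ⟧ * ⟦ divides (tailₘ ν) μ ⟧) (<ᵇ-suc (x1exp ν) m) ⟩
  ⟦ x1exp ν ≤ᵇ m ⟧ * ⟦ divides (tailₘ ν) μ ⟧
    ≡⟨ sym (⟦⟧-∧ (x1exp ν ≤ᵇ m) _) ⟩
  ⟦ (x1exp ν ≤ᵇ m) ∧ divides (tailₘ ν) μ ⟧
    ≡⟨ cong ⟦_⟧ (sym (divides-x1exp∷tailₘ ν (m ∷ μ))) ⟩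
  ⟦ divides ν (m ∷ μ) ⟧ ∎
  where
  open ≡-Reasoning
  column : ∀ i → sumL (λ d → ⟦ sameMon (i ∷ d) ν ⟧) (divisors μ) ≡ ⟦ i ≡ᵇ x1exp ν ⟧ * ⟦ divides (tailₘ ν) μ ⟧
  column i = begin
    sumL (λ d → ⟦ sameMon (i ∷ d) ν ⟧) (divisors μ)
      ≡⟨ sumL-cong (divisors μ) (λ d → trans (cong ⟦_⟧ (sameMon-cons i d ν)) (⟦⟧-∧ (i ≡ᵇ x1exp ν) _)) ⟩
    sumL (λ d → ⟦ i ≡ᵇ x1exp ν ⟧ * ⟦ sameMon d (tailₘ ν) ⟧) (divisors μ)
      ≡⟨ sumL-*ˡ ⟦ i ≡ᵇ x1exp ν ⟧ (λ d → ⟦ sameMon d (tailₘ ν) ⟧) (divisors μ) ⟩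
    ⟦ i ≡ᵇ x1exp ν ⟧ * sumL (λ d → ⟦ sameMon d (tailₘ ν) ⟧) (divisors μ)
      ≡⟨ cong (⟦ i ≡ᵇ x1exp ν ⟧ *_) (sym (countB≡sumL _ (divisors μ))) ⟩
    ⟦ i ≡ᵇ x1exp ν ⟧ * countB (λ d → sameMon d (tailₘ ν)) (divisors μ)
      ≡⟨ cong (⟦ i ≡ᵇ x1exp ν ⟧ *_) (divisors-count μ (tailₘ ν)) ⟩
    ⟦ i ≡ᵇ x1exp ν ⟧ * ⟦ divides (tailₘ ν) μ ⟧ ∎

mon-⊛ : ∀ ν g → Respects≈ₘ g → ∀ μ → (mon ν ⊛ g) μ ≡ (if divides ν μ then g (μ ∸ₘ ν) else + 0)
mon-⊛ ν g g-resp μ = begin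
  (mon ν ⊛ g) μ
    ≡⟨ sumℤ-indicator (λ d → sameMon d ν) (λ d → g (zipWith _∸_ μ d)) (g (μ ∸ₘ ν)) (divisors μ) cofactor ⟩
  + countB (λ d → sameMon d ν) (divisors μ) ℤ.* g (μ ∸ₘ ν)
    ≡⟨ cong (λ k → + k ℤ.* g (μ ∸ₘ ν)) (divisors-count μ ν) ⟩
  + ⟦ divides ν μ ⟧ ℤ.* g (μ ∸ₘ ν)
    ≡⟨ select (divides ν μ) ⟩
  (if divides ν μ then g (μ ∸ₘ ν) else + 0) ∎
  where
  open ≡-Reasoning
  cofactor : ∀ d → d ∈ divisors μ → sameMon d ν ≡ true → g (zipWith _∸_ μ d) ≡ g (μ ∸ₘ ν)
  cofactor d m e =
    g-resp _ _ (≈ₘ-trans (proj₁ (divisor-cofactor μ d m)) (∸ₘ-resp (≈ₘ-refl {μ}) (sameMon⇒≈ₘ d ν e)))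
  select : ∀ b → + ⟦ b ⟧ ℤ.* g (μ ∸ₘ ν) ≡ (if b then g (μ ∸ₘ ν) else + 0)
  select true = ℤP.*-identityˡ (g (μ ∸ₘ ν))
  select false = ℤP.*-zeroˡ (g (μ ∸ₘ ν))

mon-⊛-mon : ∀ ν ρ → (mon ν ⊛ mon ρ) ≗ mon (ν +ₘ ρ)
mon-⊛-mon ν ρ μ = begin
  (mon ν ⊛ mon ρ) μ
    ≡⟨ mon-⊛ ν (mon ρ) (mon-resp ρ) μ ⟩
  (if divides ν μ then ℤ⟦ sameMon (μ ∸ₘ ν) ρ ⟧ else + 0)
    ≡⟨ if-ℤ⟦⟧ (divides ν μ) (sameMon (μ ∸ₘ ν) ρ) ⟩
  ℤ⟦ divides ν μ ∧ sameMon (μ ∸ₘ ν) ρ ⟧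
    ≡⟨ cong (λ b → ℤ⟦ divides ν μ ∧ b ⟧) (sameMon-sym (μ ∸ₘ ν) ρ) ⟩
  ℤ⟦ divides ν μ ∧ sameMon ρ (μ ∸ₘ ν) ⟧
    ≡⟨ cong ℤ⟦_⟧ (sym (trans (sameMon-sym μ (ν +ₘ ρ)) (sameMon-+ₘˡ ν ρ μ))) ⟩
  ℤ⟦ sameMon μ (ν +ₘ ρ) ⟧ ∎
  where
  open ≡-Reasoning
  if-ℤ⟦⟧ : ∀ a b → (if a then ℤ⟦ b ⟧ else + 0) ≡ ℤ⟦ a ∧ b ⟧
  if-ℤ⟦⟧ true b = refl
  if-ℤ⟦⟧ false b = refl

mult : List Monomial → Monomial → ℕ
mult L ν = countB (λ ρ → sameMon ρ ν) L

mult≡sumL : ∀ L ν → mult L ν ≡ sumL (λ ρ → ⟦ sameMon ρ ν ⟧) L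
mult≡sumL L ν = countB≡sumL (λ ρ → sameMon ρ ν) L

mult-resp : ∀ L ν ν′ → ν ≈ₘ ν′ → mult L ν ≡ mult L ν′
mult-resp [] ν ν′ h = refl
mult-resp (ρ ∷ L) ν ν′ h = cong₂ _+_ (cong (λ b → if b then 1 else 0) (sameMon-resp ρ ρ ν ν′ ≈ₘ-refl h)) (mult-resp L ν ν′ h)

mult-concatMap : {A : Set} (g : A → List Monomial) (xs : List A) (ν : Monomial) →
  mult (concatMap g xs) ν ≡ sumL (λ x → mult (g x) ν) xs
mult-concatMap g xs ν =
  trans (mult≡sumL (concatMap g xs) ν)
        (trans (sumL-concatMap (λ ρ → ⟦ sameMon ρ ν ⟧) g xs) (sumL-cong xs (λ x → sym (mult≡sumL (g x) ν))))

mult-singleton : ∀ ρ t → + mult (ρ ∷ []) t ≡ ℤ⟦ sameMon ρ t ⟧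
mult-singleton ρ t with sameMon ρ t
... | true = refl
... | false = refl

if-ℤ : ∀ b k → (if b then + k else + 0) ≡ + (⟦ b ⟧ * k)
if-ℤ true k = cong +_ (sym (+-identityʳ k))
if-ℤ false k = refl

mult-map-+ₘ : ∀ ν L μ → mult (map (ν +ₘ_) L) μ ≡ ⟦ divides ν μ ⟧ * mult L (μ ∸ₘ ν)
mult-map-+ₘ ν [] μ = sym (*-zeroʳ ⟦ divides ν μ ⟧)
mult-map-+ₘ ν (ρ ∷ L) μ = begin
  (if sameMon (ν +ₘ ρ) μ then 1 else 0) + mult (map (ν +ₘ_) L) μ
    ≡⟨ cong₂ _+_ (trans (if-⟦⟧ _) (trans (cong ⟦_⟧ (sameMon-+ₘˡ ν ρ μ)) (⟦⟧-∧ (divides ν μ) _))) (mult-map-+ₘ ν L μ) ⟩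
  ⟦ divides ν μ ⟧ * ⟦ sameMon ρ (μ ∸ₘ ν) ⟧ + ⟦ divides ν μ ⟧ * mult L (μ ∸ₘ ν)
    ≡⟨ sym (*-distribˡ-+ ⟦ divides ν μ ⟧ _ _) ⟩
  ⟦ divides ν μ ⟧ * (⟦ sameMon ρ (μ ∸ₘ ν) ⟧ + mult L (μ ∸ₘ ν))
    ≡⟨ cong (λ k → ⟦ divides ν μ ⟧ * (k + mult L (μ ∸ₘ ν))) (sym (if-⟦⟧ _)) ⟩
  ⟦ divides ν μ ⟧ * mult (ρ ∷ L) (μ ∸ₘ ν) ∎
  where open ≡-Reasoning

-- A graded list A lists, for each L, the monomials ρ in x₂, x₃, … (stored from
-- index 0 on) such that x₁^L ρ occurs in the series, with multiplicity.
Graded : Set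
Graded = ℕ → List Monomial

series : Graded → Series
series A μ = + mult (A (x1exp μ)) (tailₘ μ)

series-resp : ∀ A → Respects≈ₘ (series A)
series-resp A μ μ′ h rewrite x1exp-resp h =
  cong +_ (mult-resp (A (x1exp μ′)) (tailₘ μ) (tailₘ μ′) (tailₘ-resp h))

One : Graded
One zero = [] ∷ []
One (suc _) = []

const1≗series-One : const (+ 1) ≗ series One
const1≗series-One μ = trans (cong ℤ⟦_⟧ (sameMon-[] μ)) (degree (x1exp μ))
  where
  degree : ∀ h → ℤ⟦ (h ≡ᵇ 0) ∧ sameMon (tailₘ μ) [] ⟧ ≡ + mult (One h) (tailₘ μ)
  degree zero = trans (cong ℤ⟦_⟧ (sameMon-sym (tailₘ μ) [])) (sym (mult-singleton [] (tailₘ μ)))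
  degree (suc h) = refl

_⊗_ : Graded → Graded → Graded
(A ⊗ B) L = concatMap (λ i → concatMap (λ ρ → map (ρ +ₘ_) (B (L ∸ i))) (A i)) (upTo (suc L))
infixr 7 _⊗_

sumL-*-swap : {D X Y : Set} (f : X → D → ℕ) (g : Y → D → ℕ) (ds : List D) (xs : List X) (ys : List Y) →
  sumL (λ d → sumL (λ a → f a d) xs * sumL (λ b → g b d) ys) ds ≡
  sumL (λ a → sumL (λ b → sumL (λ d → f a d * g b d) ds) ys) xs
sumL-*-swap f g ds xs ys = begin
  sumL (λ d → sumL (λ a → f a d) xs * sumL (λ b → g b d) ys) ds
    ≡⟨ sumL-cong ds (λ d → trans (sym (sumL-*ʳ (sumL (λ b → g b d) ys) (λ a → f a d) xs))
                                 (sumL-cong xs (λ a → sym (sumL-*ˡ (f a d) (λ b → g b d) ys)))) ⟩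
  sumL (λ d → sumL (λ a → sumL (λ b → f a d * g b d) ys) xs) ds
    ≡⟨ sumL-swap (λ d a → sumL (λ b → f a d * g b d) ys) ds xs ⟩
  sumL (λ a → sumL (λ d → sumL (λ b → f a d * g b d) ys) ds) xs
    ≡⟨ sumL-cong xs (λ a → sumL-swap (λ d b → f a d * g b d) ds ys) ⟩
  sumL (λ a → sumL (λ b → sumL (λ d → f a d * g b d) ds) ys) xs ∎
  where open ≡-Reasoning

divisors-split : ∀ ν ρ μ →
  sumL (λ d → ⟦ sameMon ν d ⟧ * ⟦ sameMon ρ (zipWith _∸_ μ d) ⟧) (divisors μ) ≡ ⟦ sameMon (ν +ₘ ρ) μ ⟧
divisors-split ν ρ μ = begin
  sumL (λ d → ⟦ sameMon ν d ⟧ * ⟦ sameMon ρ (zipWith _∸_ μ d) ⟧) (divisors μ)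
    ≡⟨ sumL-cong (divisors μ) (λ d → cong (λ b → ⟦ b ⟧ * ⟦ sameMon ρ (zipWith _∸_ μ d) ⟧) (sameMon-sym ν d)) ⟩
  sumL (λ d → ⟦ sameMon d ν ⟧ * ⟦ sameMon ρ (zipWith _∸_ μ d) ⟧) (divisors μ)
    ≡⟨ sumL-indicator (λ d → sameMon d ν) (λ d → ⟦ sameMon ρ (zipWith _∸_ μ d) ⟧) ⟦ sameMon ρ (μ ∸ₘ ν) ⟧ (divisors μ) cofactor ⟩
  countB (λ d → sameMon d ν) (divisors μ) * ⟦ sameMon ρ (μ ∸ₘ ν) ⟧
    ≡⟨ cong (_* ⟦ sameMon ρ (μ ∸ₘ ν) ⟧) (divisors-count μ ν) ⟩
  ⟦ divides ν μ ⟧ * ⟦ sameMon ρ (μ ∸ₘ ν) ⟧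
    ≡⟨ sym (⟦⟧-∧ (divides ν μ) _) ⟩
  ⟦ divides ν μ ∧ sameMon ρ (μ ∸ₘ ν) ⟧
    ≡⟨ cong ⟦_⟧ (sym (sameMon-+ₘˡ ν ρ μ)) ⟩
  ⟦ sameMon (ν +ₘ ρ) μ ⟧ ∎
  where
  open ≡-Reasoning
  cofactor : ∀ d → d ∈ divisors μ → sameMon d ν ≡ true →
             ⟦ sameMon ρ (zipWith _∸_ μ d) ⟧ ≡ ⟦ sameMon ρ (μ ∸ₘ ν) ⟧
  cofactor d m e = cong ⟦_⟧ (sameMon-resp ρ ρ _ _ ≈ₘ-refl
    (≈ₘ-trans (proj₁ (divisor-cofactor μ d m)) (∸ₘ-resp (≈ₘ-refl {μ}) (sameMon⇒≈ₘ d ν e))))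

divisors-split-mult : ∀ As Bs μ →
  sumL (λ d → mult As d * mult Bs (zipWith _∸_ μ d)) (divisors μ) ≡
  sumL (λ ν → sumL (λ ρ → ⟦ sameMon (ν +ₘ ρ) μ ⟧) Bs) As
divisors-split-mult As Bs μ = begin
  sumL (λ d → mult As d * mult Bs (zipWith _∸_ μ d)) (divisors μ)
    ≡⟨ sumL-cong (divisors μ) (λ d → cong₂ _*_ (mult≡sumL As d) (mult≡sumL Bs (zipWith _∸_ μ d))) ⟩
  sumL (λ d → sumL (λ ν → ⟦ sameMon ν d ⟧) As * sumL (λ ρ → ⟦ sameMon ρ (zipWith _∸_ μ d) ⟧) Bs) (divisors μ)
    ≡⟨ sumL-*-swap (λ ν d → ⟦ sameMon ν d ⟧) (λ ρ d → ⟦ sameMon ρ (zipWith _∸_ μ d) ⟧) (divisors μ) As Bs ⟩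
  sumL (λ ν → sumL (λ ρ → sumL (λ d → ⟦ sameMon ν d ⟧ * ⟦ sameMon ρ (zipWith _∸_ μ d) ⟧) (divisors μ)) Bs) As
    ≡⟨ sumL-cong As (λ ν → sumL-cong Bs (λ ρ → divisors-split ν ρ μ)) ⟩
  sumL (λ ν → sumL (λ ρ → ⟦ sameMon (ν +ₘ ρ) μ ⟧) Bs) As ∎
  where open ≡-Reasoning

mult-⊗ : ∀ A B L μ →
  mult ((A ⊗ B) L) μ ≡ sumL (λ i → sumL (λ ν → sumL (λ ρ → ⟦ sameMon (ν +ₘ ρ) μ ⟧) (B (L ∸ i))) (A i)) (upTo (suc L))
mult-⊗ A B L μ =
  trans (mult≡sumL ((A ⊗ B) L) μ)
   (trans (sumL-concatMap (λ σ → ⟦ sameMon σ μ ⟧) (λ i → concatMap (λ ν → map (ν +ₘ_) (B (L ∸ i))) (A i)) (upTo (suc L)))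
    (sumL-cong (upTo (suc L)) (λ i →
      trans (sumL-concatMap (λ σ → ⟦ sameMon σ μ ⟧) (λ ν → map (ν +ₘ_) (B (L ∸ i))) (A i))
            (sumL-cong (A i) (λ ν → sumL-map (λ σ → ⟦ sameMon σ μ ⟧) (ν +ₘ_) (B (L ∸ i)))))))

series-⊛ : ∀ A B → (series A ⊛ series B) ≗ series (A ⊗ B)
series-⊛ A B μ =
  trans (sumℤ-cong (divisors μ) (λ d _ → sym (ℤP.pos-* (mult (A (x1exp d)) (tailₘ d)) _)))
        (trans (sumℤ-pos (term μ) (divisors μ)) (cong +_ (coefficient μ)))
  where
  term : Monomial → Monomial → ℕ
  term μ d = mult (A (x1exp d)) (tailₘ d) * mult (B (x1exp (zipWith _∸_ μ d))) (tailₘ (zipWith _∸_ μ d))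
  coefficient : ∀ μ → sumL (term μ) (divisors μ) ≡ mult ((A ⊗ B) (x1exp μ)) (tailₘ μ)
  coefficient [] = trans (divisors-split-mult (A 0) (B 0) []) (sym (trans (mult-⊗ A B 0 []) (+-identityʳ _)))
  coefficient (m ∷ μ) =
    trans (sumL-concatMap (term (m ∷ μ)) (λ i → map (i ∷_) (divisors μ)) (upTo (suc m)))
     (trans (sumL-cong (upTo (suc m)) (λ i →
              trans (sumL-map (term (m ∷ μ)) (i ∷_) (divisors μ)) (divisors-split-mult (A i) (B (m ∸ i)) μ)))
            (sym (mult-⊗ A B m μ)))

_^ₘ_ : Monomial → ℕ → Monomial
ν ^ₘ zero = []
ν ^ₘ suc c = ν +ₘ ν ^ₘ c

mon-^ₛ : ∀ ν c → (mon ν ^ₛ c) ≗ mon (ν ^ₘ c)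
mon-^ₛ ν zero μ = refl
mon-^ₛ ν (suc c) μ = trans (⊛-cong {mon ν} (λ _ → refl) (mon-^ₛ ν c) μ) (mon-⊛-mon ν (ν ^ₘ c) μ)

exponent-^ₘ : ∀ ν c j → exponent (ν ^ₘ c) j ≡ c * exponent ν j
exponent-^ₘ ν zero j = refl
exponent-^ₘ ν (suc c) j = trans (exponent-+ₘ ν (ν ^ₘ c) j) (cong (_+_ (exponent ν j)) (exponent-^ₘ ν c j))

prodₘ : (ℕ → Monomial) → (ℕ → ℕ) → List ℕ → Monomial
prodₘ U c = foldr (λ k ν → U k ^ₘ c k +ₘ ν) []

prodₛ-mon : (U : ℕ → Monomial) (c : ℕ → ℕ) (ks : List ℕ) →
  prodₛ (map (λ k → mon (U k) ^ₛ c k) ks) ≗ mon (prodₘ U c ks)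
prodₛ-mon U c [] μ = refl
prodₛ-mon U c (k ∷ ks) μ =
  trans (⊛-cong (mon-^ₛ (U k) (c k)) (prodₛ-mon U c ks) μ) (mon-⊛-mon (U k ^ₘ c k) _ μ)

exponent-prodₘ : (U : ℕ → Monomial) (c : ℕ → ℕ) (ks : List ℕ) (j : ℕ) →
  exponent (prodₘ U c ks) j ≡ sumL (λ k → c k * exponent (U k) j) ks
exponent-prodₘ U c [] j = refl
exponent-prodₘ U c (k ∷ ks) j =
  trans (exponent-+ₘ (U k ^ₘ c k) _ j) (cong₂ _+_ (exponent-^ₘ (U k) (c k) j) (exponent-prodₘ U c ks j))

exponent-unitVec : ∀ i j → exponent (unitVec i) j ≡ ⟦ i ≡ᵇ j ⟧
exponent-unitVec zero zero = refl
exponent-unitVec zero (suc j) = refl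
exponent-unitVec (suc i) zero = refl
exponent-unitVec (suc i) (suc j) = exponent-unitVec i j

P-monomial : ℕ → Monomial
P-monomial n = prodₘ (λ k → unitVec (k + 2 ∸ 1)) (n C_) (upTo (suc n))

P≗mon : ∀ n → P n ≗ mon (P-monomial n)
P≗mon n = prodₛ-mon (λ k → unitVec (k + 2 ∸ 1)) (n C_) (upTo (suc n))

k+2∸1≡1+k : ∀ k → k + 2 ∸ 1 ≡ suc k
k+2∸1≡1+k k = cong (_∸ 1) (+-comm k 2)

⟦<ᵇ⟧*C : ∀ n j → ⟦ j <ᵇ suc n ⟧ * (n C j) ≡ n C j
⟦<ᵇ⟧*C n j with j <ᵇ suc n in e
... | true = +-identityʳ _
... | false = sym (k>n⇒nCk≡0 {n} {j} (≰⇒> (λ j≤n → subst T e (<⇒<ᵇ (s≤s j≤n)))))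

exponent-P-monomial-0 : ∀ n → exponent (P-monomial n) 0 ≡ 0
exponent-P-monomial-0 n =
  trans (exponent-prodₘ (λ k → unitVec (k + 2 ∸ 1)) (n C_) (upTo (suc n)) 0)
        (sumL-zero (upTo (suc n)) (λ k _ →
          trans (cong (λ u → (n C k) * exponent (unitVec u) 0) (k+2∸1≡1+k k)) (*-zeroʳ (n C k))))

exponent-P-monomial-suc : ∀ n j → exponent (P-monomial n) (suc j) ≡ n C j
exponent-P-monomial-suc n j = begin
  exponent (P-monomial n) (suc j)
    ≡⟨ exponent-prodₘ (λ k → unitVec (k + 2 ∸ 1)) (n C_) (upTo (suc n)) (suc j) ⟩
  sumL (λ k → (n C k) * exponent (unitVec (k + 2 ∸ 1)) (suc j)) (upTo (suc n))
    ≡⟨ sumL-cong (upTo (suc n)) term ⟩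
  sumL (λ k → ⟦ k ≡ᵇ j ⟧ * (n C k)) (upTo (suc n))
    ≡⟨ sumL-upTo-δ (suc n) j (n C_) ⟩
  ⟦ j <ᵇ suc n ⟧ * (n C j)
    ≡⟨ ⟦<ᵇ⟧*C n j ⟩
  n C j ∎
  where
  open ≡-Reasoning
  term : ∀ k → (n C k) * exponent (unitVec (k + 2 ∸ 1)) (suc j) ≡ ⟦ k ≡ᵇ j ⟧ * (n C k)
  term k = trans (cong (λ u → (n C k) * exponent (unitVec u) (suc j)) (k+2∸1≡1+k k))
                 (trans (cong ((n C k) *_) (exponent-unitVec k j)) (*-comm (n C k) ⟦ k ≡ᵇ j ⟧))

pascalRow : ℕ → Monomial
pascalRow n = tailₘ (P-monomial n)

exponent-pascalRow : ∀ n j → exponent (pascalRow n) j ≡ n C j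
exponent-pascalRow n j = trans (sym (exponent-suc (P-monomial n) j)) (exponent-P-monomial-suc n j)

x₁P≗mon : ∀ n → (x 1 ⊛ P n) ≗ mon (1 ∷ pascalRow n)
x₁P≗mon n μ =
  trans (⊛-cong {x 1} (λ _ → refl) (P≗mon n) μ)
        (trans (mon-⊛-mon (1 ∷ []) (P-monomial n) μ) (mon-cong ((1 ∷ []) +ₘ P-monomial n) (1 ∷ pascalRow n) (mk≈ same) μ))
  where
  same : ∀ j → exponent ((1 ∷ []) +ₘ P-monomial n) j ≡ exponent (1 ∷ pascalRow n) j
  same zero = trans (exponent-+ₘ (1 ∷ []) (P-monomial n) 0) (cong suc (exponent-P-monomial-0 n))
  same (suc j) = trans (exponent-+ₘ (1 ∷ []) (P-monomial n) (suc j)) (exponent-suc (P-monomial n) j)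

x₁mon-⊛-series : ∀ ρ G ν → (mon (1 ∷ ρ) ⊛ series G) ν ≡
  (if (1 ≤ᵇ x1exp ν) ∧ divides ρ (tailₘ ν) then + mult (G (x1exp ν ∸ 1)) (tailₘ ν ∸ₘ ρ) else + 0)
x₁mon-⊛-series ρ G ν =
  trans (mon-⊛ (1 ∷ ρ) (series G) (series-resp G) ν)
        (cong₂ (λ b z → if b then z else + 0) (divides-x1exp∷tailₘ (1 ∷ ρ) ν) (series-resp G _ _ cofactor≈))
  where
  cofactor≈ : ν ∸ₘ (1 ∷ ρ) ≈ₘ (x1exp ν ∸ 1) ∷ (tailₘ ν ∸ₘ ρ)
  cofactor≈ = mk≈ λ
    { zero → trans (exponent-∸ₘ ν (1 ∷ ρ) 0) (cong (_∸ 1) (exponent-0 ν))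
    ; (suc j) → trans (exponent-∸ₘ ν (1 ∷ ρ) (suc j))
                      (trans (cong (_∸ exponent ρ j) (exponent-suc ν j)) (sym (exponent-∸ₘ (tailₘ ν) ρ j))) }

denominator : ℕ → Series → Series
denominator n g = const (+ 1) ⊝ x 1 ⊕ x 1 ⊛ P n ⊝ x 1 ⊛ P n ⊛ g

-- If G is the series of the next level, then 1 minus the level-n denominator is
-- x₁ + x₁Pₙ(G − 1): a first-return block is a single point or x₁Pₙ times a
-- nonempty avoider of the next level.
module Denominator (n : ℕ) (G : Graded) (G₀ : G 0 ≡ [] ∷ []) where

  Block : Graded
  Block zero = []
  Block (suc zero) = [] ∷ []
  Block (suc (suc s)) = map (pascalRow n +ₘ_) (G (suc s))

  oneMinusDenominator : Series
  oneMinusDenominator = const (+ 1) ⊝ denominator n (series G)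

  private
    ρ : Monomial
    ρ = pascalRow n

    rearrange : ∀ c a X Y → c ℤ.- ((c ℤ.- a ℤ.+ X) ℤ.- Y) ≡ (a ℤ.- X) ℤ.+ Y
    rearrange = solve 4 (λ c a X Y → c :- ((c :- a :+ X) :- Y) := (a :- X) :+ Y) refl
      where open ℤSolver.+-*-Solver

    cancel : ∀ a b → (a ℤ.- b) ℤ.+ b ≡ a
    cancel = solve 2 (λ a b → (a :- b) :+ b := a) refl
      where open ℤSolver.+-*-Solver

    single : ∀ t → (if divides ρ t then + mult ([] ∷ []) (t ∸ₘ ρ) else + 0) ≡ ℤ⟦ sameMon ρ t ⟧
    single t = begin
      (if divides ρ t then + mult ([] ∷ []) (t ∸ₘ ρ) else + 0)
        ≡⟨ if-ℤ (divides ρ t) _ ⟩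
      + (⟦ divides ρ t ⟧ * mult ([] ∷ []) (t ∸ₘ ρ))
        ≡⟨ cong +_ (sym (mult-map-+ₘ ρ ([] ∷ []) t)) ⟩
      + mult ((ρ +ₘ []) ∷ []) t
        ≡⟨ mult-singleton (ρ +ₘ []) t ⟩
      ℤ⟦ sameMon (ρ +ₘ []) t ⟧
        ≡⟨ cong ℤ⟦_⟧ (sameMon-resp (ρ +ₘ []) ρ t t ρ+[]≈ρ ≈ₘ-refl) ⟩
      ℤ⟦ sameMon ρ t ⟧ ∎
      where
      open ≡-Reasoning
      ρ+[]≈ρ : ρ +ₘ [] ≈ₘ ρ
      ρ+[]≈ρ = mk≈ λ j → trans (exponent-+ₘ ρ [] j) (+-identityʳ _)

    coefficient : ∀ h t →
      (ℤ⟦ (1 ≡ᵇ h) ∧ sameMon [] t ⟧ ℤ.- ℤ⟦ (1 ≡ᵇ h) ∧ sameMon ρ t ⟧) ℤ.+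
      (if (1 ≤ᵇ h) ∧ divides ρ t then + mult (G (h ∸ 1)) (t ∸ₘ ρ) else + 0) ≡ + mult (Block h) t
    coefficient zero t = refl
    coefficient (suc zero) t rewrite G₀ = begin
      (ℤ⟦ sameMon [] t ⟧ ℤ.- ℤ⟦ sameMon ρ t ⟧) ℤ.+ (if divides ρ t then + mult ([] ∷ []) (t ∸ₘ ρ) else + 0)
        ≡⟨ cong (ℤ._+_ (ℤ⟦ sameMon [] t ⟧ ℤ.- ℤ⟦ sameMon ρ t ⟧)) (single t) ⟩
      (ℤ⟦ sameMon [] t ⟧ ℤ.- ℤ⟦ sameMon ρ t ⟧) ℤ.+ ℤ⟦ sameMon ρ t ⟧
        ≡⟨ cancel ℤ⟦ sameMon [] t ⟧ ℤ⟦ sameMon ρ t ⟧ ⟩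
      ℤ⟦ sameMon [] t ⟧
        ≡⟨ sym (mult-singleton [] t) ⟩
      + mult ([] ∷ []) t ∎
      where open ≡-Reasoning
    coefficient (suc (suc s)) t =
      trans (ℤP.+-identityˡ _) (trans (if-ℤ (divides ρ t) _) (cong +_ (sym (mult-map-+ₘ ρ (G (suc s)) t))))

  oneMinusDenominator≗series-Block : oneMinusDenominator ≗ series Block
  oneMinusDenominator≗series-Block ν = begin
    oneMinusDenominator ν
      ≡⟨ rearrange (const (+ 1) ν) (x 1 ν) ((x 1 ⊛ P n) ν) ((x 1 ⊛ P n ⊛ series G) ν) ⟩
    (x 1 ν ℤ.- (x 1 ⊛ P n) ν) ℤ.+ (x 1 ⊛ P n ⊛ series G) ν
      ≡⟨ cong₂ (λ a b → (x 1 ν ℤ.- a) ℤ.+ b) (x₁P≗mon n ν) (⊛-cong {g = series G} (x₁P≗mon n) (λ _ → refl) ν) ⟩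
    (mon (1 ∷ []) ν ℤ.- mon (1 ∷ ρ) ν) ℤ.+ (mon (1 ∷ ρ) ⊛ series G) ν
      ≡⟨ cong₂ ℤ._+_ (cong₂ ℤ._-_ (mon-∷ 1 [] ν) (mon-∷ 1 ρ ν)) (x₁mon-⊛-series ρ G ν) ⟩
    (ℤ⟦ (1 ≡ᵇ x1exp ν) ∧ sameMon [] (tailₘ ν) ⟧ ℤ.- ℤ⟦ (1 ≡ᵇ x1exp ν) ∧ sameMon ρ (tailₘ ν) ⟧) ℤ.+
      (if (1 ≤ᵇ x1exp ν) ∧ divides ρ (tailₘ ν) then + mult (G (x1exp ν ∸ 1)) (tailₘ ν ∸ₘ ρ) else + 0)
      ≡⟨ coefficient (x1exp ν) (tailₘ ν) ⟩
    series Block ν ∎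
    where open ≡-Reasoning

gradedPow : Graded → ℕ → Graded
gradedPow H zero = One
gradedPow H (suc k) = H ⊗ gradedPow H k

^ₛ≗series-gradedPow : ∀ g H → g ≗ series H → ∀ k → (g ^ₛ k) ≗ series (gradedPow H k)
^ₛ≗series-gradedPow g H h zero = const1≗series-One
^ₛ≗series-gradedPow g H h (suc k) μ =
  trans (⊛-cong h (^ₛ≗series-gradedPow g H h k) μ) (series-⊛ H (gradedPow H k) μ)

^ₛ-cong-local : ∀ g g′ K → (∀ ν → x1exp ν < K → g ν ≡ g′ ν) → ∀ k ν → x1exp ν < K → (g ^ₛ k) ν ≡ (g′ ^ₛ k) ν
^ₛ-cong-local g g′ K h zero ν lt = refl
^ₛ-cong-local g g′ K h (suc k) ν lt = ⊛-cong-local g g′ (g ^ₛ k) (g′ ^ₛ k) ν λ d m →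
  h d (≤-<-trans (proj₂ (divisor-cofactor ν d m)) lt) ,
  ^ₛ-cong-local g g′ K h k (zipWith _∸_ ν d) (≤-<-trans (x1exp-cofactor-≤ ν d m) lt)

inv≡sum : ∀ f H μ → (∀ k → ((const (+ 1) ⊝ f) ^ₛ k) μ ≡ series (gradedPow H k) μ) →
  inv f μ ≡ + sumL (λ k → mult (gradedPow H k (x1exp μ)) (tailₘ μ)) (upTo (suc (deg μ)))
inv≡sum f H μ h =
  trans (sumℤ-cong (upTo (suc (deg μ))) (λ k _ → h k))
        (sumℤ-pos (λ k → mult (gradedPow H k (x1exp μ)) (tailₘ μ)) (upTo (suc (deg μ))))

Unique-concatMap : ∀ {A B : Set} (g : A → List B) (label : B → A) (xs : List A) → Unique xs →
  (∀ x → x ∈ xs → Unique (g x)) → (∀ x y → x ∈ xs → y ∈ g x → label y ≡ x) → Unique (concatMap g xs)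
Unique-concatMap g label [] u ug hl = []
Unique-concatMap g label (x ∷ xs) (x∉ ∷ u) ug hl =
  UP.++⁺ (ug x (here refl)) (Unique-concatMap g label xs u (λ x′ m → ug x′ (there m)) (λ x′ y m → hl x′ y (there m)))
         (λ (m₁ , m₂) → disjoint m₁ m₂)
  where
  disjoint : ∀ {y} → y ∈ g x → y ∈ concatMap g xs → ⊥
  disjoint {y} m₁ m₂ with x′ , mx′ , my ← ∈-concatMap⁻′ g xs m₂ =
    All.lookup x∉ mx′ (trans (sym (hl x y (here refl) m₁)) (hl x′ y (there mx′) my))

Unique-map-injectiveOn : ∀ {A B : Set} (f : A → B) (xs : List A) → Unique xs →
  (∀ x y → x ∈ xs → y ∈ xs → f x ≡ f y → x ≡ y) → Unique (map f xs)
Unique-map-injectiveOn f [] u inj = []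
Unique-map-injectiveOn f (x ∷ xs) (x∉ ∷ u) inj =
  All.tabulate (λ {z} mz → fresh z mz) ∷ Unique-map-injectiveOn f xs u (λ a b ma mb → inj a b (there ma) (there mb))
  where
  fresh : ∀ z → z ∈ map f xs → ¬ (f x ≡ z)
  fresh z mz e with y , my , refl ← ∈-map⁻ f mz = All.lookup x∉ my (inj x y (here refl) (there my) e)

Unique-drop-mid : {A : Set} (xs : List A) {y : A} {ys : List A} → Unique (xs ++ y ∷ ys) → Unique (xs ++ ys)
Unique-drop-mid [] (_ ∷ u) = u
Unique-drop-mid (x ∷ xs) (x∉ ∷ u) = AllP.++⁺ (AllP.++⁻ˡ xs x∉) (All.tail (AllP.++⁻ʳ xs x∉)) ∷ Unique-drop-mid xs u

Unique-mid-∉ : {A : Set} (xs : List A) {y : A} {ys : List A} → Unique (xs ++ y ∷ ys) → y ∉ xs ++ ys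
Unique-mid-∉ [] (y∉ ∷ u) m = All.lookup y∉ m refl
Unique-mid-∉ (x ∷ xs) (x∉ ∷ u) (here refl) = All.lookup x∉ (∈-++⁺ʳ xs (here refl)) refl
Unique-mid-∉ (x ∷ xs) (x∉ ∷ u) (there m) = Unique-mid-∉ xs u m

Unique-++-disjoint : {A : Set} (xs : List A) {ys : List A} {x : A} → Unique (xs ++ ys) → x ∈ xs → x ∈ ys → ⊥
Unique-++-disjoint (x′ ∷ xs) (x∉ ∷ u) (here refl) my = All.lookup x∉ (∈-++⁺ʳ xs my) refl
Unique-++-disjoint (x′ ∷ xs) (x∉ ∷ u) (there mx) my = Unique-++-disjoint xs u mx my

Unique-resp-↭ : {A : Set} {xs ys : List A} → xs ↭ ys → Unique xs → Unique ys
Unique-resp-↭ {A} p = ↭ₛP.Unique-resp-↭ (setoid A) (↭⇒↭ₛ p)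

∈-++-∷⁻ : {A : Set} (xs : List A) {y : A} {ys : List A} {z : A} → z ∈ xs ++ y ∷ ys → z ≢ y → z ∈ xs ++ ys
∈-++-∷⁻ [] (here e) ne = ⊥-elim (ne e)
∈-++-∷⁻ [] (there m) ne = m
∈-++-∷⁻ (x ∷ xs) (here e) ne = here e
∈-++-∷⁻ (x ∷ xs) (there m) ne = there (∈-++-∷⁻ xs m ne)

∈-++-∷⁺ : {A : Set} (xs : List A) {y : A} {ys : List A} {z : A} → z ∈ xs ++ ys → z ∈ xs ++ y ∷ ys
∈-++-∷⁺ [] m = there m
∈-++-∷⁺ (x ∷ xs) (here e) = here e
∈-++-∷⁺ (x ∷ xs) (there m) = there (∈-++-∷⁺ xs m)

countB-map : {A B : Set} (p : B → Bool) (f : A → B) (xs : List A) → countB p (map f xs) ≡ countB (λ x → p (f x)) xs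
countB-map p f [] = refl
countB-map p f (x ∷ xs) = cong (_+_ (if p (f x) then 1 else 0)) (countB-map p f xs)

countB-cong-local : {A : Set} (p q : A → Bool) (xs : List A) → (∀ x → x ∈ xs → p x ≡ q x) → countB p xs ≡ countB q xs
countB-cong-local p q [] h = refl
countB-cong-local p q (x ∷ xs) h =
  cong₂ _+_ (cong (λ b → if b then 1 else 0) (h x (here refl))) (countB-cong-local p q xs (λ y m → h y (there m)))

countB-mid : {A : Set} (p : A → Bool) (xs : List A) {y : A} {ys : List A} →
  countB p (xs ++ y ∷ ys) ≡ (if p y then 1 else 0) + countB p (xs ++ ys)
countB-mid p [] = refl
countB-mid p (x ∷ xs) {y} {ys} =
  trans (cong (_+_ (if p x then 1 else 0)) (countB-mid p xs))
        (trans (sym (+-assoc (if p x then 1 else 0) _ _))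
               (trans (cong (_+ countB p (xs ++ ys)) (+-comm (if p x then 1 else 0) (if p y then 1 else 0)))
                      (+-assoc (if p y then 1 else 0) _ _)))

countB-∧-restrict : {A : Set} (p q : A → Bool) (As Bs : List A) → Unique As → Unique Bs →
  (∀ z → z ∈ Bs → (z ∈ As) × (p z ≡ true)) → (∀ z → z ∈ As → p z ≡ true → z ∈ Bs) →
  countB (λ z → p z ∧ q z) As ≡ countB q Bs
countB-∧-restrict p q [] [] uA uB sound complete = refl
countB-∧-restrict p q [] (b ∷ Bs) uA uB sound complete with () ← proj₁ (sound b (here refl))
countB-∧-restrict p q (a ∷ As) Bs (a∉ ∷ uA) uB sound complete with p a in pa
... | false = countB-∧-restrict p q As Bs uA uB (λ z m → sound′ z m , proj₂ (sound z m)) (λ z m → complete z (there m))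
  where
  sound′ : ∀ z → z ∈ Bs → z ∈ As
  sound′ z m with sound z m
  ... | here refl , pz = ⊥-elim (BoolP.not-¬ refl (trans (sym pa) pz))
  ... | there m′ , _ = m′
... | true with Bs₁ , Bs₂ , refl ← ∈-∃++ (complete a (here refl) pa) =
  trans (cong (_+_ (if q a then 1 else 0)) rest) (sym (countB-mid q Bs₁))
  where
  sound′ : ∀ z → z ∈ Bs₁ ++ Bs₂ → z ∈ As
  sound′ z m with proj₁ (sound z (∈-++-∷⁺ Bs₁ m))
  ... | here refl = ⊥-elim (Unique-mid-∉ Bs₁ uB m)
  ... | there m′ = m′
  rest : countB (λ z → p z ∧ q z) As ≡ countB q (Bs₁ ++ Bs₂)
  rest = countB-∧-restrict p q As (Bs₁ ++ Bs₂) uA (Unique-drop-mid Bs₁ uB)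
    (λ z m → sound′ z m , proj₂ (sound z (∈-++-∷⁺ Bs₁ m)))
    (λ z m pz → ∈-++-∷⁻ Bs₁ (complete z (there m) pz) (λ { refl → All.lookup a∉ m refl }))

data Tree : Set where
  leaf : Tree
  node : Tree → Tree → Tree

size : Tree → ℕ
size leaf = 0
size (node a b) = suc (size a + size b)

spine : Tree → ℕ
spine leaf = 0
spine (node a b) = suc (spine b)

spine≤size : ∀ t → spine t ≤ size t
spine≤size leaf = z≤n
spine≤size (node a b) = s≤s (≤-trans (spine≤size b) (m≤n+m (size b) (size a)))

leftSize : Tree → ℕ
leftSize leaf = 0
leftSize (node a b) = size a

leftChild : Tree → Tree
leftChild leaf = leaf
leftChild (node a b) = a

nodes : List Tree → List Tree → List Tree
nodes as bs = concatMap (λ a → map (node a) bs) as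

∈-nodes⁻ : ∀ as bs {t} → t ∈ nodes as bs → ∃ λ a → ∃ λ b → a ∈ as × b ∈ bs × t ≡ node a b
∈-nodes⁻ as bs m
  with a , ma , m′ ← ∈-concatMap⁻′ (λ a → map (node a) bs) as m
  with b , mb , refl ← ∈-map⁻ (node a) m′ = a , b , ma , mb , refl

∈-nodes⁺ : ∀ {as bs a b} → a ∈ as → b ∈ bs → node a b ∈ nodes as bs
∈-nodes⁺ {bs = bs} {a} ma mb = ∈-concatMap⁺′ (λ a → map (node a) bs) ma (∈-map⁺ (node a) mb)

nodes-unique : ∀ as bs → Unique as → Unique bs → Unique (nodes as bs)
nodes-unique as bs uas ubs =
  Unique-concatMap (λ a → map (node a) bs) leftChild as uas
    (λ a _ → Unique-map-injectiveOn (node a) bs ubs (λ { _ _ _ _ refl → refl }))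
    (λ a t _ m → leftChild-node a t m)
  where
  leftChild-node : ∀ a t → t ∈ map (node a) bs → leftChild t ≡ a
  leftChild-node a t m with b , _ , refl ← ∈-map⁻ (node a) m = refl

-- treesBySpine f k L lists the trees of size L whose right spine has length k.
-- The fuel f is only needed for termination; any f > L gives the same list.
treesBySpine : ℕ → ℕ → ℕ → List Tree
treesOfSize : ℕ → ℕ → List Tree
treesBySpine zero k L = []
treesBySpine (suc f) zero zero = leaf ∷ []
treesBySpine (suc f) zero (suc L) = []
treesBySpine (suc f) (suc k) L = concatMap (λ s → nodes (treesOfSize f s) (treesBySpine f k (L ∸ suc s))) (upTo L)
treesOfSize f s = concatMap (λ k → treesBySpine f k s) (upTo (suc s))

Trees : ℕ → List Tree
Trees L = treesOfSize (suc L) L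

spineTrees : ℕ → ℕ → List Tree
spineTrees k L = treesBySpine (suc L) k L

concatMap-cong-upTo : {B : Set} (L : ℕ) (h h′ : ℕ → List B) → (∀ s → s < L → h s ≡ h′ s) →
  concatMap h (upTo L) ≡ concatMap h′ (upTo L)
concatMap-cong-upTo L h h′ eq = cong concat (LP.map-cong-local (All.tabulate (λ m → eq _ (∈-upTo⁻ m))))

concatMap-upTo-suc : {B : Set} (h : ℕ → List B) (L : ℕ) →
  concatMap h (upTo (suc L)) ≡ h 0 ++ concatMap (λ s → h (suc s)) (upTo L)
concatMap-upTo-suc h L = cong (h 0 ++_) (trans (cong (concatMap h) (sym (LP.map-upTo suc L))) (LP.concatMap-map h suc (upTo L)))

concatMap-[] : {A B : Set} (xs : List A) → concatMap {B = B} (λ _ → []) xs ≡ []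
concatMap-[] [] = refl
concatMap-[] (x ∷ xs) = concatMap-[] xs

∸-suc-< : ∀ {s L} → s < L → L ∸ suc s < L
∸-suc-< {s} {L} s<L = ∸-monoʳ-< {L} {suc s} {0} (s≤s z≤n) s<L

treesBySpine-fuel : ∀ f f′ k L → L < f → L < f′ → treesBySpine f k L ≡ treesBySpine f′ k L
treesOfSize-fuel : ∀ f f′ s → s < f → s < f′ → treesOfSize f s ≡ treesOfSize f′ s
treesBySpine-fuel (suc f) (suc f′) zero zero lt lt′ = refl
treesBySpine-fuel (suc f) (suc f′) zero (suc L) lt lt′ = refl
treesBySpine-fuel (suc f) (suc f′) (suc k) L lt lt′ = concatMap-cong-upTo L _ _ λ s s<L →
  cong₂ nodes
    (treesOfSize-fuel f f′ s (<-≤-trans s<L (≤-pred lt)) (<-≤-trans s<L (≤-pred lt′)))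
    (treesBySpine-fuel f f′ k (L ∸ suc s) (<-≤-trans (∸-suc-< s<L) (≤-pred lt)) (<-≤-trans (∸-suc-< s<L) (≤-pred lt′)))
treesOfSize-fuel f f′ s lt lt′ = LP.concatMap-cong (λ k → treesBySpine-fuel f f′ k s lt lt′) (upTo (suc s))

treesBySpine-long-spine : ∀ f k L → L < k → treesBySpine f k L ≡ []
treesBySpine-long-spine zero k L lt = refl
treesBySpine-long-spine (suc f) (suc k) L lt =
  trans (concatMap-cong-upTo L _ (λ _ → []) λ s s<L →
          trans (cong (nodes (treesOfSize f s)) (treesBySpine-long-spine f k (L ∸ suc s) (<-≤-trans (∸-suc-< s<L) (≤-pred lt))))
                (concatMap-[] (treesOfSize f s)))
        (concatMap-[] (upTo L))

size-treesBySpine : ∀ f k L t → t ∈ treesBySpine f k L → size t ≡ L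
size-treesOfSize : ∀ f s t → t ∈ treesOfSize f s → size t ≡ s
size-treesBySpine (suc f) zero zero t (here refl) = refl
size-treesBySpine (suc f) (suc k) L t m
  with s , ms , m′ ← ∈-concatMap⁻′ (λ s → nodes (treesOfSize f s) (treesBySpine f k (L ∸ suc s))) (upTo L) m
  with a , b , ma , mb , refl ← ∈-nodes⁻ (treesOfSize f s) (treesBySpine f k (L ∸ suc s)) m′ =
  trans (cong suc (cong₂ _+_ (size-treesOfSize f s a ma) (size-treesBySpine f k (L ∸ suc s) b mb)))
        (split s L (∈-upTo⁻ ms))
  where
  split : ∀ s L → s < L → suc (s + (L ∸ suc s)) ≡ L
  split s (suc L) (s≤s s≤L) = cong suc (m+[n∸m]≡n s≤L)
size-treesOfSize f s t m with k , _ , m′ ← ∈-concatMap⁻′ (λ k → treesBySpine f k s) (upTo (suc s)) m =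
  size-treesBySpine f k s t m′

spine-treesBySpine : ∀ f k L t → t ∈ treesBySpine f k L → spine t ≡ k
spine-treesBySpine (suc f) zero zero t (here refl) = refl
spine-treesBySpine (suc f) (suc k) L t m
  with s , ms , m′ ← ∈-concatMap⁻′ (λ s → nodes (treesOfSize f s) (treesBySpine f k (L ∸ suc s))) (upTo L) m
  with a , b , ma , mb , refl ← ∈-nodes⁻ (treesOfSize f s) (treesBySpine f k (L ∸ suc s)) m′ =
  cong suc (spine-treesBySpine f k (L ∸ suc s) b mb)

∈-treesBySpine : ∀ f t → size t < f → t ∈ treesBySpine f (spine t) (size t)
∈-treesOfSize : ∀ f t → size t < f → t ∈ treesOfSize f (size t)
∈-treesBySpine (suc f) leaf lt = here refl
∈-treesBySpine (suc f) (node a b) (s≤s lt) =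
  ∈-concatMap⁺′ (λ s → nodes (treesOfSize f s) (treesBySpine f (spine b) (suc (size a + size b) ∸ suc s)))
    (∈-upTo⁺ (s≤s (m≤m+n (size a) (size b))))
    (∈-nodes⁺ a∈ (subst (λ L → b ∈ treesBySpine f (spine b) L) (sym (m+n∸m≡n (size a) (size b))) b∈))
  where
  a∈ = ∈-treesOfSize f a (<-≤-trans (s≤s (m≤m+n (size a) (size b))) lt)
  b∈ = ∈-treesBySpine f b (<-≤-trans (s≤s (m≤n+m (size b) (size a))) lt)
∈-treesOfSize f t lt = ∈-concatMap⁺′ (λ k → treesBySpine f k (size t)) (∈-upTo⁺ (s≤s (spine≤size t))) (∈-treesBySpine f t lt)

∈-Trees : ∀ t → t ∈ Trees (size t)
∈-Trees t = ∈-treesOfSize (suc (size t)) t ≤-refl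

treesBySpine-unique : ∀ f k L → Unique (treesBySpine f k L)
treesOfSize-unique : ∀ f s → Unique (treesOfSize f s)
treesBySpine-unique zero k L = []
treesBySpine-unique (suc f) zero zero = [] ∷ []
treesBySpine-unique (suc f) zero (suc L) = []
treesBySpine-unique (suc f) (suc k) L =
  Unique-concatMap (λ s → nodes (treesOfSize f s) (treesBySpine f k (L ∸ suc s))) leftSize (upTo L) (UP.upTo⁺ L)
    (λ s _ → nodes-unique _ _ (treesOfSize-unique f s) (treesBySpine-unique f k (L ∸ suc s)))
    (λ s t _ m → leftSize-∈ s t m)
  where
  leftSize-∈ : ∀ s t → t ∈ nodes (treesOfSize f s) (treesBySpine f k (L ∸ suc s)) → leftSize t ≡ s
  leftSize-∈ s t m with a , b , ma , _ , refl ← ∈-nodes⁻ (treesOfSize f s) _ m = size-treesOfSize f s a ma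
treesOfSize-unique f s =
  Unique-concatMap (λ k → treesBySpine f k s) spine (upTo (suc s)) (UP.upTo⁺ (suc s))
    (λ k _ → treesBySpine-unique f k s) (λ k t _ m → spine-treesBySpine f k s t m)

-- treeWeight n t is the monomial in x₂, x₃, … of the structure encoded by t at
-- level n of the continued fraction: the nodes on the right spine are its
-- first-return blocks, and a nonempty left subtree is a block x₁Pₙ·(level n+1).
treeWeight : ℕ → Tree → Monomial
branchWeight : ℕ → Tree → Monomial
treeWeight n leaf = []
treeWeight n (node a b) = branchWeight n a +ₘ treeWeight n b
branchWeight n leaf = []
branchWeight n (node c d) = pascalRow n +ₘ treeWeight (suc n) (node c d)

treeWeights : ℕ → Graded
treeWeights n L = map (treeWeight n) (Trees L)

blocks : ℕ → Graded
blocks n = Denominator.Block n (treeWeights (suc n)) refl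

branchWeights≡blocks : ∀ n s → map (branchWeight n) (Trees s) ≡ blocks n (suc s)
branchWeights≡blocks n zero = refl
branchWeights≡blocks n (suc s) =
  trans (LP.map-cong-local (All.tabulate λ {t} m → nonempty t (size-treesOfSize (suc (suc s)) (suc s) t m)))
        (LP.map-∘ (Trees (suc s)))
  where
  nonempty : ∀ t → size t ≡ suc s → branchWeight n t ≡ pascalRow n +ₘ treeWeight (suc n) t
  nonempty (node c d) _ = refl

spineTrees-weights : ∀ n k L → map (treeWeight n) (spineTrees k L) ≡ gradedPow (blocks n) k L
spineTrees-weights n zero zero = refl
spineTrees-weights n zero (suc L) = refl
spineTrees-weights n (suc k) L = begin
  map (treeWeight n) (concatMap (λ s → nodes (treesOfSize L s) (treesBySpine L k (L ∸ suc s))) (upTo L))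
    ≡⟨ LP.map-concatMap (treeWeight n) _ (upTo L) ⟩
  concatMap (λ s → map (treeWeight n) (nodes (treesOfSize L s) (treesBySpine L k (L ∸ suc s)))) (upTo L)
    ≡⟨ concatMap-cong-upTo L _ _ firstBlock ⟩
  concatMap (λ s → products s (blocks n (suc s))) (upTo L)
    ≡⟨ sym (concatMap-upTo-suc (λ i → concatMap (λ h → map (h +ₘ_) (gradedPow (blocks n) k (L ∸ i))) (blocks n i)) L) ⟩
  gradedPow (blocks n) (suc k) L ∎
  where
  open ≡-Reasoning
  products : ℕ → List Monomial → List Monomial
  products s hs = concatMap (λ h → map (h +ₘ_) (gradedPow (blocks n) k (L ∸ suc s))) hs
  firstBlock : ∀ s → s < L →
    map (treeWeight n) (nodes (treesOfSize L s) (treesBySpine L k (L ∸ suc s))) ≡ products s (blocks n (suc s))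
  firstBlock s s<L = begin
    map (treeWeight n) (nodes (treesOfSize L s) (treesBySpine L k (L ∸ suc s)))
      ≡⟨ cong₂ (λ as bs → map (treeWeight n) (nodes as bs))
           (treesOfSize-fuel L (suc s) s s<L ≤-refl)
           (treesBySpine-fuel L (suc (L ∸ suc s)) k (L ∸ suc s) (∸-suc-< s<L) ≤-refl) ⟩
    map (treeWeight n) (nodes (Trees s) (spineTrees k (L ∸ suc s)))
      ≡⟨ LP.map-concatMap (treeWeight n) _ (Trees s) ⟩
    concatMap (λ a → map (treeWeight n) (map (node a) (spineTrees k (L ∸ suc s)))) (Trees s)
      ≡⟨ LP.concatMap-cong (λ a → trans (sym (LP.map-∘ (spineTrees k (L ∸ suc s))))
                                         (trans (LP.map-∘ (spineTrees k (L ∸ suc s)))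
                                                (cong (map (branchWeight n a +ₘ_)) (spineTrees-weights n k (L ∸ suc s)))))
                           (Trees s) ⟩
    concatMap (λ a → map (branchWeight n a +ₘ_) (gradedPow (blocks n) k (L ∸ suc s))) (Trees s)
      ≡⟨ sym (LP.concatMap-map (λ h → map (h +ₘ_) (gradedPow (blocks n) k (L ∸ suc s))) (branchWeight n) (Trees s)) ⟩
    products s (map (branchWeight n) (Trees s))
      ≡⟨ cong (products s) (branchWeights≡blocks n s) ⟩
    products s (blocks n (suc s)) ∎

mult-treeWeights : ∀ n L ν → mult (treeWeights n L) ν ≡ sumL (λ k → mult (gradedPow (blocks n) k L) ν) (upTo (suc L))
mult-treeWeights n L ν =
  trans (cong (λ ρs → mult ρs ν)
              (trans (LP.map-concatMap (treeWeight n) (λ k → spineTrees k L) (upTo (suc L)))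
                     (LP.concatMap-cong (λ k → spineTrees-weights n k L) (upTo (suc L)))))
        (mult-concatMap (λ k → gradedPow (blocks n) k L) (upTo (suc L)) ν)

mult-gradedPow-blocks-vanish : ∀ n k L ν → L < k → mult (gradedPow (blocks n) k L) ν ≡ 0
mult-gradedPow-blocks-vanish n k L ν lt =
  trans (cong (λ ρs → mult ρs ν) (sym (spineTrees-weights n k L)))
        (cong (λ ts → mult (map (treeWeight n) ts) ν) (treesBySpine-long-spine (suc L) k L lt))

∸-< : ∀ {a b m} → 0 < a → a ≤ b → b ≤ m → b ∸ a < m
∸-< {a} {b} {m} 0<a a≤b b≤m = <-≤-trans (∸-monoʳ-< {b} {a} {0} 0<a a≤b) b≤m

-- Since x₁ divides x₁Pₙ, the coefficient of ν in x₁Pₙ g only involves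
-- coefficients of g of smaller x₁-degree.
denominator-local : ∀ n g g′ m ν → x1exp ν < suc m → (∀ ρ → x1exp ρ < m → g ρ ≡ g′ ρ) →
  denominator n g ν ≡ denominator n g′ ν
denominator-local n g g′ m ν ν<1+m g≡g′ =
  cong (ℤ._-_ (const (+ 1) ν ℤ.- x 1 ν ℤ.+ (x 1 ⊛ P n) ν)) (⊛-congʳ-local (x 1 ⊛ P n) g g′ ν term)
  where
  term : ∀ d → d ∈ divisors ν → ((x 1 ⊛ P n) d ≡ + 0) ⊎ (g (zipWith _∸_ ν d) ≡ g′ (zipWith _∸_ ν d))
  term d mem with x1exp d in e
  ... | zero = inj₁ (trans (x₁P≗mon n d) (trans (mon-∷ 1 (pascalRow n) d) (cong (λ h → ℤ⟦ (1 ≡ᵇ h) ∧ sameMon (pascalRow n) (tailₘ d) ⟧) e)))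
  ... | suc h = inj₂ (g≡g′ _ (subst (_< m) (sym (x1exp-cofactor ν d mem))
                         (∸-< (subst (0 <_) (sym e) (s≤s z≤n)) (proj₂ (divisor-cofactor ν d mem)) (≤-pred ν<1+m))))

x1exp≤deg : ∀ μ → x1exp μ ≤ deg μ
x1exp≤deg [] = z≤n
x1exp≤deg (a ∷ μ) = m≤m+n a _

cf≗series-treeWeights : ∀ m n μ → x1exp μ < m → cf m n μ ≡ series (treeWeights n) μ
cf≗series-treeWeights (suc m) n μ lt = begin
  inv (denominator n (cf m (suc n))) μ
    ≡⟨ inv≡sum _ (blocks n) μ powers ⟩
  + sumL (λ k → mult (gradedPow (blocks n) k (x1exp μ)) (tailₘ μ)) (upTo (suc (deg μ)))
    ≡⟨ cong +_ (sumL-upTo-extend _ (x1exp μ) (deg μ) (x1exp≤deg μ) (λ k → mult-gradedPow-blocks-vanish n k (x1exp μ) (tailₘ μ))) ⟩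
  + sumL (λ k → mult (gradedPow (blocks n) k (x1exp μ)) (tailₘ μ)) (upTo (suc (x1exp μ)))
    ≡⟨ cong +_ (sym (mult-treeWeights n (x1exp μ) (tailₘ μ))) ⟩
  series (treeWeights n) μ ∎
  where
  open ≡-Reasoning
  open Denominator n (treeWeights (suc n)) refl
  agree : ∀ ν → x1exp ν < suc m → (const (+ 1) ⊝ denominator n (cf m (suc n))) ν ≡ oneMinusDenominator ν
  agree ν ν<1+m = cong (ℤ._-_ (const (+ 1) ν))
    (denominator-local n _ _ m ν ν<1+m (λ ρ ρ<m → cf≗series-treeWeights m (suc n) ρ ρ<m))
  powers : ∀ k → ((const (+ 1) ⊝ denominator n (cf m (suc n))) ^ₛ k) μ ≡ series (gradedPow (blocks n) k) μ
  powers k = trans (^ₛ-cong-local _ _ (suc m) agree k μ lt)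
                   (^ₛ≗series-gradedPow _ (blocks n) oneMinusDenominator≗series-Block k μ)

insertions-↭ : ∀ a σ {π} → π ∈ insertions a σ → π ↭ a ∷ σ
insertions-↭ a [] (here refl) = ↭.refl
insertions-↭ a (y ∷ ys) (here refl) = ↭.refl
insertions-↭ a (y ∷ ys) (there m) with π′ , m′ , refl ← ∈-map⁻ (y ∷_) m =
  ↭.trans (↭.prep y (insertions-↭ a ys m′)) (↭.swap y a ↭.refl)

∈-insertions : ∀ a p s → p ++ a ∷ s ∈ insertions a (p ++ s)
∈-insertions a [] [] = here refl
∈-insertions a [] (x ∷ s) = here refl
∈-insertions a (y ∷ p) s = there (∈-map⁺ (y ∷_) (∈-insertions a p s))

∈-perms⇒↭ : ∀ xs {π} → π ∈ perms xs → π ↭ xs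
∈-perms⇒↭ [] (here refl) = ↭.refl
∈-perms⇒↭ (a ∷ as) m with σ , mσ , mπ ← ∈-concatMap⁻′ (insertions a) (perms as) m =
  ↭.trans (insertions-↭ a σ mπ) (↭.prep a (∈-perms⇒↭ as mσ))

↭⇒∈-perms : ∀ xs {π} → π ↭ xs → π ∈ perms xs
↭⇒∈-perms [] r rewrite ↭P.↭-empty-inv r = here refl
↭⇒∈-perms (a ∷ as) r with p , s , refl ← ∈-∃++ (↭P.∈-resp-↭ (↭.↭-sym r) (here refl)) =
  ∈-concatMap⁺′ (insertions a) (↭⇒∈-perms as (↭P.drop-mid p [] r)) (∈-insertions a p s)

remove : ℕ → List ℕ → List ℕ
remove a [] = []
remove a (y ∷ ys) = if a ≡ᵇ y then ys else y ∷ remove a ys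

≡ᵇ-refl : ∀ a → (a ≡ᵇ a) ≡ true
≡ᵇ-refl a = T⇒≡true (≡⇒≡ᵇ a a refl)

≢⇒≡ᵇ≡false : ∀ a y → a ≢ y → (a ≡ᵇ y) ≡ false
≢⇒≡ᵇ≡false a y ne with a ≡ᵇ y in e
... | true = ⊥-elim (ne (≡ᵇ≡true⇒≡ e))
... | false = refl

remove-insertions : ∀ a σ {π} → a ∉ σ → π ∈ insertions a σ → remove a π ≡ σ
remove-insertions a [] a∉ (here refl) rewrite ≡ᵇ-refl a = refl
remove-insertions a (y ∷ ys) a∉ (here refl) rewrite ≡ᵇ-refl a = refl
remove-insertions a (y ∷ ys) a∉ (there m) with π′ , m′ , refl ← ∈-map⁻ (y ∷_) m
  rewrite ≢⇒≡ᵇ≡false a y (λ e → a∉ (here e)) = cong (y ∷_) (remove-insertions a ys (λ z → a∉ (there z)) m′)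

insertions-unique : ∀ a σ → a ∉ σ → Unique (insertions a σ)
insertions-unique a [] a∉ = [] ∷ []
insertions-unique a (y ∷ ys) a∉ =
  All.tabulate (λ {z} mz e → fresh z mz e)
  ∷ Unique-map-injectiveOn (y ∷_) (insertions a ys) (insertions-unique a ys (λ z → a∉ (there z))) (λ _ _ _ _ → LP.∷-injectiveʳ)
  where
  fresh : ∀ z → z ∈ map (y ∷_) (insertions a ys) → (a ∷ y ∷ ys) ≡ z → ⊥
  fresh z mz e with w , _ , refl ← ∈-map⁻ (y ∷_) mz = a∉ (here (LP.∷-injectiveˡ e))

perms-unique : ∀ xs → Unique xs → Unique (perms xs)
perms-unique [] u = [] ∷ []
perms-unique (a ∷ as) (a∉ ∷ u) =
  Unique-concatMap (insertions a) (remove a) (perms as) (perms-unique as u)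
    (λ σ mσ → insertions-unique a σ (a∉σ σ mσ))
    (λ σ π mσ mπ → remove-insertions a σ (a∉σ σ mσ) mπ)
  where
  a∉σ : ∀ σ → σ ∈ perms as → a ∉ σ
  a∉σ σ mσ m = All.lookup a∉ (↭P.∈-resp-↭ (∈-perms⇒↭ as mσ) m) refl

∨-≡false⁻ : ∀ {a b} → a ∨ b ≡ false → (a ≡ false) × (b ≡ false)
∨-≡false⁻ {false} e = refl , e

∨-≡false⁺ : ∀ {a b} → a ≡ false → b ≡ false → a ∨ b ≡ false
∨-≡false⁺ refl refl = refl

∨-≡trueˡ : ∀ {a} b → a ≡ true → a ∨ b ≡ true
∨-≡trueˡ b refl = refl

∨-≡trueʳ : ∀ a {b} → b ≡ true → a ∨ b ≡ true
∨-≡trueʳ true e = refl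
∨-≡trueʳ false e = e

<⇒<ᵇ≡true : ∀ {a b} → a < b → (a <ᵇ b) ≡ true
<⇒<ᵇ≡true lt = T⇒≡true (<⇒<ᵇ lt)

≤⇒>ᵇ≡false : ∀ {a b} → b ≤ a → (a <ᵇ b) ≡ false
≤⇒>ᵇ≡false {a} {b} le with a <ᵇ b in e
... | true = ⊥-elim (<⇒≱ (<ᵇ⇒< a b (≡true⇒T e)) le)
... | false = refl

<ᵇ≡true⇒< : ∀ {a b} → (a <ᵇ b) ≡ true → a < b
<ᵇ≡true⇒< {a} {b} e = <ᵇ⇒< a b (≡true⇒T e)

any-++ : {A : Set} (p : A → Bool) (xs ys : List A) → any p (xs ++ ys) ≡ any p xs ∨ any p ys
any-++ p [] ys = refl
any-++ p (x ∷ xs) ys rewrite any-++ p xs ys = sym (BoolP.∨-assoc (p x) _ _)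

any-≡false : {A : Set} (p : A → Bool) (xs : List A) → (∀ z → z ∈ xs → p z ≡ false) → any p xs ≡ false
any-≡false p [] h = refl
any-≡false p (x ∷ xs) h = ∨-≡false⁺ (h x (here refl)) (any-≡false p xs (λ z m → h z (there m)))

any-≡true : {A : Set} (p : A → Bool) (xs : List A) {z : A} → z ∈ xs → p z ≡ true → any p xs ≡ true
any-≡true p (x ∷ xs) (here refl) e = ∨-≡trueˡ _ e
any-≡true p (x ∷ xs) (there m) e = ∨-≡trueʳ (p x) (any-≡true p xs m e)

no-32-below : ∀ v y β → All (_< v) β → any (λ z → (v <ᵇ z) ∧ (z <ᵇ y)) β ≡ false
no-32-below v y β hβ = any-≡false _ β (λ z m → cong (_∧ (z <ᵇ y)) (≤⇒>ᵇ≡false (<⇒≤ (All.lookup hβ m))))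

has32above-below : ∀ v β → All (_< v) β → has32above v β ≡ false
has32above-below v [] h = refl
has32above-below v (y ∷ zs) (_ ∷ h) = ∨-≡false⁺ (no-32-below v y zs h) (has32above-below v zs h)

has32above-++ : ∀ v xs M β → has32above v xs ≡ false → All (_< v) β → All (_< M) xs → v < M →
  has32above v (xs ++ M ∷ β) ≡ false
has32above-++ v [] M β e hβ hx v<M = ∨-≡false⁺ (no-32-below v M β hβ) (has32above-below v β hβ)
has32above-++ v (y ∷ xs) M β e hβ (y<M ∷ hx) v<M =
  ∨-≡false⁺ (trans (any-++ (λ z → (v <ᵇ z) ∧ (z <ᵇ y)) xs (M ∷ β))
                   (∨-≡false⁺ (proj₁ (∨-≡false⁻ {any (λ z → (v <ᵇ z) ∧ (z <ᵇ y)) xs} e))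
                              (∨-≡false⁺ (trans (cong ((v <ᵇ M) ∧_) (≤⇒>ᵇ≡false (<⇒≤ y<M))) (BoolP.∧-zeroʳ _))
                                         (no-32-below v y β hβ))))
            (has32above-++ v xs M β (proj₂ (∨-≡false⁻ e)) hβ hx v<M)

contains132-++ : ∀ α M β → contains132 α ≡ false → contains132 β ≡ false →
  All (λ a → All (_< a) β) α → All (_< M) α → All (_< M) β → contains132 (α ++ M ∷ β) ≡ false
contains132-++ [] M β eα eβ h hα hβ = ∨-≡false⁺ (has32above-below M β hβ) eβ
contains132-++ (a ∷ α) M β eα eβ (ha ∷ h) (a<M ∷ hα) hβ =
  ∨-≡false⁺ (has32above-++ a α M β (proj₁ (∨-≡false⁻ eα)) ha hα a<M)
            (contains132-++ α M β (proj₂ (∨-≡false⁻ eα)) eβ h hα hβ)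

has32above-prefix : ∀ v xs ys → has32above v (xs ++ ys) ≡ false → has32above v xs ≡ false
has32above-prefix v [] ys e = refl
has32above-prefix v (y ∷ xs) ys e =
  ∨-≡false⁺ (proj₁ (∨-≡false⁻ {any _ xs} (trans (sym (any-++ _ xs ys)) (proj₁ (∨-≡false⁻ e)))))
            (has32above-prefix v xs ys (proj₂ (∨-≡false⁻ e)))

has32above-suffix : ∀ v xs ys → has32above v ys ≡ true → has32above v (xs ++ ys) ≡ true
has32above-suffix v [] ys e = e
has32above-suffix v (y ∷ xs) ys e = ∨-≡trueʳ _ (has32above-suffix v xs ys e)

contains132-prefix : ∀ xs ys → contains132 (xs ++ ys) ≡ false → contains132 xs ≡ false
contains132-prefix [] ys e = refl
contains132-prefix (x ∷ xs) ys e =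
  ∨-≡false⁺ (has32above-prefix x xs ys (proj₁ (∨-≡false⁻ e))) (contains132-prefix xs ys (proj₂ (∨-≡false⁻ e)))

contains132-suffix : ∀ xs ys → contains132 (xs ++ ys) ≡ false → contains132 ys ≡ false
contains132-suffix [] ys e = e
contains132-suffix (x ∷ xs) ys e = contains132-suffix xs ys (proj₂ (∨-≡false⁻ e))

contains132-split : ∀ α M β {a b} → contains132 (α ++ M ∷ β) ≡ false → a ∈ α → b ∈ β → b < M → ¬ (a < b)
contains132-split (a ∷ α) M β {b = b} e (here refl) mb b<M a<b =
  BoolP.not-¬ refl (trans (sym (has32above-suffix a α (M ∷ β) (∨-≡trueˡ _ a<b<M))) (proj₁ (∨-≡false⁻ e)))
  where
  a<b<M : any (λ z → (a <ᵇ z) ∧ (z <ᵇ M)) β ≡ true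
  a<b<M = any-≡true _ β mb (trans (cong (_∧ (b <ᵇ M)) (<⇒<ᵇ≡true a<b)) (<⇒<ᵇ≡true b<M))
contains132-split (x ∷ α) M β e (there ma) mb b<M a<b = contains132-split α M β (proj₂ (∨-≡false⁻ e)) ma mb b<M a<b

Descending : List ℕ → Set
Descending = AllPairs (λ x y → y < x)

Descending⇒Unique : ∀ {xs} → Descending xs → Unique xs
Descending⇒Unique d = AP.map (λ lt e → <-irrefl (sym e) lt) d

Descending-take-drop : ∀ k xs → Descending xs → All (λ x → All (_< x) (drop k xs)) (take k xs)
Descending-take-drop zero xs d = []
Descending-take-drop (suc k) [] d = []
Descending-take-drop (suc k) (x ∷ xs) (x> ∷ d) = AllP.drop⁺ k x> ∷ Descending-take-drop k xs d

Descending-downFrom : ∀ L → Descending (downFrom L)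
Descending-downFrom zero = []
Descending-downFrom (suc L) = below L ∷ Descending-downFrom L
  where
  below : ∀ L → All (_< L) (downFrom L)
  below zero = []
  below (suc L) = ≤-refl ∷ All.map m<n⇒m<1+n (below L)

length-take-drop : {A : Set} (m n : ℕ) (xs : List A) → m + n ≡ length xs → (m ≡ length (take m xs)) × (n ≡ length (drop m xs))
length-take-drop m n xs e =
  sym (trans (LP.length-take m xs) (m≤n⇒m⊓n≡m (subst (m ≤_) e (m≤m+n m n)))) ,
  sym (trans (LP.length-drop m xs) (trans (cong (_∸ m) (sym e)) (m+n∸m≡n m n)))

length-take≤ : {A : Set} (k : ℕ) (xs : List A) → length (take k xs) ≤ length xs
length-take≤ k xs = subst (_≤ length xs) (sym (LP.length-take k xs)) (m⊓n≤n k (length xs))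

length-drop≤ : {A : Set} (k : ℕ) (xs : List A) → length (drop k xs) ≤ length xs
length-drop≤ k xs = subst (_≤ length xs) (sym (LP.length-drop k xs)) (m∸n≤m (length xs) k)

-- For descending xs, the maximum M is placed by the root; the left subtree arranges
-- the next size a values before M and the right subtree the remaining ones after it.
treePerm : Tree → List ℕ → List ℕ
treePerm leaf xs = []
treePerm (node a b) [] = []
treePerm (node a b) (M ∷ rest) = treePerm a (take (size a) rest) ++ M ∷ treePerm b (drop (size a) rest)

treePerm-↭ : ∀ t xs → size t ≡ length xs → treePerm t xs ↭ xs
treePerm-↭ leaf [] e = ↭.refl
treePerm-↭ (node a b) (M ∷ rest) e =
  ↭.trans (↭P.++⁺ (treePerm-↭ a (take (size a) rest) (proj₁ sl)) (↭.prep M (treePerm-↭ b (drop (size a) rest) (proj₂ sl))))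
          (↭.trans (↭P.shift M (take (size a) rest) (drop (size a) rest)) (↭.prep M (↭.↭-reflexive (LP.take++drop≡id (size a) rest))))
  where sl = length-take-drop (size a) (size b) rest (suc-injective e)

length-treePerm : ∀ t xs → size t ≡ length xs → length (treePerm t xs) ≡ size t
length-treePerm t xs e = trans (↭P.↭-length (treePerm-↭ t xs e)) (sym e)

All-treePerm : ∀ {Q : ℕ → Set} t xs → size t ≡ length xs → All Q xs → All Q (treePerm t xs)
All-treePerm t xs e h = ↭P.All-resp-↭ (↭.↭-sym (treePerm-↭ t xs e)) h

treePerm-avoids132 : ∀ t xs → Descending xs → size t ≡ length xs → contains132 (treePerm t xs) ≡ false
treePerm-avoids132 leaf xs d e = refl
treePerm-avoids132 (node a b) (M ∷ rest) (M> ∷ d) e =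
  contains132-++ α M β (treePerm-avoids132 a zs (APP.take⁺ (size a) d) (proj₁ sl))
                       (treePerm-avoids132 b ys (APP.drop⁺ (size a) d) (proj₂ sl))
    (All-treePerm a zs (proj₁ sl) (All.map (All-treePerm b ys (proj₂ sl)) (Descending-take-drop (size a) rest d)))
    (All-treePerm a zs (proj₁ sl) (AllP.take⁺ (size a) M>))
    (All-treePerm b ys (proj₂ sl) (AllP.drop⁺ (size a) M>))
  where
  sl = length-take-drop (size a) (size b) rest (suc-injective e)
  zs = take (size a) rest
  ys = drop (size a) rest
  α = treePerm a zs
  β = treePerm b ys

++-∷-cancel : ∀ (M : ℕ) α α′ (β β′ : List ℕ) → M ∉ α → M ∉ α′ → α ++ M ∷ β ≡ α′ ++ M ∷ β′ → (α ≡ α′) × (β ≡ β′)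
++-∷-cancel M [] [] β β′ n n′ refl = refl , refl
++-∷-cancel M [] (x ∷ α′) β β′ n n′ refl = ⊥-elim (n′ (here refl))
++-∷-cancel M (x ∷ α) [] β β′ n n′ refl = ⊥-elim (n (here refl))
++-∷-cancel M (x ∷ α) (x′ ∷ α′) β β′ n n′ e with refl , e′ ← LP.∷-injective e
  with refl , refl ← ++-∷-cancel M α α′ β β′ (λ m → n (there m)) (λ m → n′ (there m)) e′ = refl , refl

∉-below : ∀ {M xs} → All (_< M) xs → M ∉ xs
∉-below h m = <-irrefl refl (All.lookup h m)

treePerm-injective : ∀ t t′ xs → Descending xs → size t ≡ length xs → size t′ ≡ length xs →
  treePerm t xs ≡ treePerm t′ xs → t ≡ t′
treePerm-injective leaf leaf xs d e e′ eq = refl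
treePerm-injective leaf (node a′ b′) [] d e () eq
treePerm-injective (node a b) leaf [] d () e′ eq
treePerm-injective leaf (node a′ b′) (x ∷ xs) d () e′ eq
treePerm-injective (node a b) leaf (x ∷ xs) d e () eq
treePerm-injective (node a b) (node a′ b′) (M ∷ rest) (M> ∷ d) e e′ eq = cong₂ node a≡a′ b≡b′
  where
  sl = length-take-drop (size a) (size b) rest (suc-injective e)
  sl′ = length-take-drop (size a′) (size b′) rest (suc-injective e′)
  halves = ++-∷-cancel M _ _ _ _ (∉-below (All-treePerm a _ (proj₁ sl) (AllP.take⁺ (size a) M>)))
                                 (∉-below (All-treePerm a′ _ (proj₁ sl′) (AllP.take⁺ (size a′) M>))) eq
  size-a : size a ≡ size a′
  size-a = trans (sym (length-treePerm a _ (proj₁ sl))) (trans (cong length (proj₁ halves)) (length-treePerm a′ _ (proj₁ sl′)))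
  a≡a′ : a ≡ a′
  a≡a′ = treePerm-injective a a′ (take (size a) rest) (APP.take⁺ (size a) d) (proj₁ sl) (trans (sym size-a) (proj₁ sl))
           (trans (proj₁ halves) (cong (λ k → treePerm a′ (take k rest)) (sym size-a)))
  b≡b′ : b ≡ b′
  b≡b′ = treePerm-injective b b′ (drop (size a) rest) (APP.drop⁺ (size a) d) (proj₂ sl)
           (trans (proj₂ sl′) (cong (λ k → length (drop k rest)) (sym size-a)))
           (trans (proj₂ halves) (cong (λ k → treePerm b′ (drop k rest)) (sym size-a)))

Descending-↭-split : ∀ xs α β → Descending xs → α ++ β ↭ xs → (∀ a b → a ∈ α → b ∈ β → b < a) →
  (α ↭ take (length α) xs) × (β ↭ drop (length α) xs)
Descending-↭-split xs [] β d r h = ↭.refl , r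
Descending-↭-split [] (a ∷ α) β d r h = ⊥-elim (↭P.¬x∷xs↭[] r)
Descending-↭-split (x ∷ xs) (a ∷ α) β (x> ∷ d) r h = peel (a ∷ α) (here refl) r h
  where
  peel : ∀ α → a ∈ α → α ++ β ↭ x ∷ xs → (∀ a b → a ∈ α → b ∈ β → b < a) →
       (α ↭ take (length α) (x ∷ xs)) × (β ↭ drop (length α) (x ∷ xs))
  peel α a∈α r h with ∈-++⁻ α (↭P.∈-resp-↭ (↭.↭-sym r) (here refl))
  ... | inj₂ x∈β = ⊥-elim (x-is-max (↭P.∈-resp-↭ r (∈-++⁺ˡ a∈α)))
    where
    x-is-max : a ∈ x ∷ xs → ⊥
    x-is-max (here refl) = <-irrefl refl (h a x a∈α x∈β)
    x-is-max (there m) = <-asym (All.lookup x> m) (h a x a∈α x∈β)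
  ... | inj₁ x∈α with α₁ , α₂ , refl ← ∈-∃++ x∈α =
    subst (λ k → α₁ ++ x ∷ α₂ ↭ take k (x ∷ xs)) (sym (LP.length-++-sucʳ α₁ x α₂)) (↭.trans (↭P.shift x α₁ α₂) (↭.prep x r₁)) ,
    subst (λ k → β ↭ drop k (x ∷ xs)) (sym (LP.length-++-sucʳ α₁ x α₂)) r₂
    where
    r′ : (α₁ ++ α₂) ++ β ↭ xs
    r′ = subst (_↭ xs) (sym (LP.++-assoc α₁ α₂ β))
               (↭P.drop-mid α₁ [] (subst (_↭ x ∷ xs) (LP.++-assoc α₁ (x ∷ α₂) β) r))
    rest = Descending-↭-split xs (α₁ ++ α₂) β d r′ (λ a′ b′ ma′ mb′ → h a′ b′ (∈-++-∷⁺ α₁ ma′) mb′)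
    r₁ = proj₁ rest
    r₂ = proj₂ rest

-- An avoider π of a descending list splits at its maximum as α M β with α above
-- β (else some a < b gives a 1-3-2 with M); recursing on α and β builds the tree.
treePerm-surjective : ∀ n xs π → length xs ≤ n → Descending xs → π ↭ xs → contains132 π ≡ false →
  ∃ λ t → (size t ≡ length xs) × (treePerm t xs ≡ π)
treePerm-surjective n [] π le d r c rewrite ↭P.↭-empty-inv r = leaf , refl , refl
treePerm-surjective (suc n) (M ∷ rest) π (s≤s le) (M> ∷ d) r c
  with α , β , refl ← ∈-∃++ (↭P.∈-resp-↭ (↭.↭-sym r) (here refl)) = split (Descending-↭-split rest α β d r₀ α>β)
  where
  r₀ : α ++ β ↭ rest
  r₀ = ↭P.drop-mid α [] r
  α>β : ∀ a b → a ∈ α → b ∈ β → b < a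
  α>β a b ma mb with <-cmp a b
  ... | tri< a<b _ _ = ⊥-elim (contains132-split α M β c ma mb (All.lookup M> (↭P.∈-resp-↭ r₀ (∈-++⁺ʳ α mb))) a<b)
  ... | tri≈ _ refl _ = ⊥-elim (Unique-++-disjoint α (Unique-resp-↭ (↭.↭-sym r₀) (Descending⇒Unique d)) ma mb)
  ... | tri> _ _ b<a = b<a
  cα : contains132 α ≡ false
  cα = contains132-prefix α (M ∷ β) c
  cβ : contains132 β ≡ false
  cβ = proj₂ (∨-≡false⁻ {has32above M β} (contains132-suffix α (M ∷ β) c))
  split : (α ↭ take (length α) rest) × (β ↭ drop (length α) rest) →
          ∃ λ t → (size t ≡ length (M ∷ rest)) × (treePerm t (M ∷ rest) ≡ α ++ M ∷ β)
  split (rα , rβ)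
    with a , size-a , a↦α ← treePerm-surjective n (take (length α) rest) α (≤-trans (length-take≤ (length α) rest) le) (APP.take⁺ (length α) d) rα cα
    with b , size-b , b↦β ← treePerm-surjective n (drop (length α) rest) β (≤-trans (length-drop≤ (length α) rest) le) (APP.drop⁺ (length α) d) rβ cβ =
    node a b ,
    cong suc (trans (cong₂ _+_ size-a size-b) (trans (sym (LP.length-++ (take (length α) rest))) (cong length (LP.take++drop≡id (length α) rest)))) ,
    trans (cong (λ k → treePerm a (take k rest) ++ M ∷ treePerm b (drop k rest)) (trans size-a (sym (↭P.↭-length rα))))
          (cong₂ (λ u v → u ++ M ∷ v) a↦α b↦β)

downFrom↭upTo : ∀ L → downFrom L ↭ upTo L
downFrom↭upTo zero = ↭.refl
downFrom↭upTo (suc L) =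
  ↭.trans (↭.prep L (downFrom↭upTo L))
   (↭.trans (subst (λ z → L ∷ z ↭ upTo L ++ L ∷ []) (LP.++-identityʳ (upTo L)) (↭.↭-sym (↭P.shift L (upTo L) [])))
            (↭.↭-reflexive (LP.upTo-∷ʳ L)))

avoiders : ℕ → List (List ℕ)
avoiders L = map (λ t → treePerm t (downFrom L)) (Trees L)

size-Trees : ∀ L t → t ∈ Trees L → size t ≡ length (downFrom L)
size-Trees L t m = trans (size-treesOfSize (suc L) L t m) (sym (LP.length-downFrom L))

avoiders-unique : ∀ L → Unique (avoiders L)
avoiders-unique L = Unique-map-injectiveOn (λ t → treePerm t (downFrom L)) (Trees L) (treesOfSize-unique (suc L) L)
  (λ t t′ m m′ → treePerm-injective t t′ (downFrom L) (Descending-downFrom L) (size-Trees L t m) (size-Trees L t′ m′))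

not-≡false : ∀ {b} → b ≡ false → not b ≡ true
not-≡false refl = refl

not-≡true : ∀ {b} → not b ≡ true → b ≡ false
not-≡true {false} _ = refl

∈-avoiders⁻ : ∀ L π → π ∈ avoiders L → (π ∈ Perms L) × (avoids132 π ≡ true)
∈-avoiders⁻ L π m with t , mt , refl ← ∈-map⁻ (λ t → treePerm t (downFrom L)) m =
  ↭⇒∈-perms (upTo L) (↭.trans (treePerm-↭ t (downFrom L) (size-Trees L t mt)) (downFrom↭upTo L)) ,
  not-≡false (treePerm-avoids132 t (downFrom L) (Descending-downFrom L) (size-Trees L t mt))

∈-avoiders⁺ : ∀ L π → π ∈ Perms L → avoids132 π ≡ true → π ∈ avoiders L
∈-avoiders⁺ L π m av
  with t , size-t , refl ← treePerm-surjective L (downFrom L) π (≤-reflexive (LP.length-downFrom L)) (Descending-downFrom L)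
                             (↭.trans (∈-perms⇒↭ (upTo L) m) (↭.↭-sym (downFrom↭upTo L))) (not-≡true av) =
  ∈-map⁺ (λ t → treePerm t (downFrom L)) (subst (λ k → t ∈ Trees k) (trans size-t (LP.length-downFrom L)) (∈-Trees t))

occs : List ℕ → ℕ → ℕ
occs π j = occ (suc (suc j)) π

pascal : (ℕ → ℕ) → ℕ → ℕ
pascal f zero = f zero
pascal f (suc j) = f (suc j) + f j

pascal^ : ℕ → (ℕ → ℕ) → ℕ → ℕ
pascal^ zero f = f
pascal^ (suc n) f = pascal (pascal^ n f)

δ : ℕ → ℕ
δ zero = 1
δ (suc _) = 0

pascal-cong : ∀ {f g} → (∀ j → f j ≡ g j) → ∀ j → pascal f j ≡ pascal g j
pascal-cong h zero = h zero
pascal-cong h (suc j) = cong₂ _+_ (h (suc j)) (h j)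

pascal^-cong : ∀ n {f g} → (∀ j → f j ≡ g j) → ∀ j → pascal^ n f j ≡ pascal^ n g j
pascal^-cong zero h j = h j
pascal^-cong (suc n) h j = pascal-cong (pascal^-cong n h) j

pascal-+ : ∀ f g j → pascal (λ i → f i + g i) j ≡ pascal f j + pascal g j
pascal-+ f g zero = refl
pascal-+ f g (suc j) = +-interchange (f (suc j)) (g (suc j)) (f j) (g j)

pascal^-+ : ∀ n f g j → pascal^ n (λ i → f i + g i) j ≡ pascal^ n f j + pascal^ n g j
pascal^-+ zero f g j = refl
pascal^-+ (suc n) f g j = trans (pascal-cong (pascal^-+ n f g) j) (pascal-+ (pascal^ n f) (pascal^ n g) j)

pascal^-0 : ∀ n j → pascal^ n (λ _ → 0) j ≡ 0
pascal^-0 zero j = refl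
pascal^-0 (suc n) zero = pascal^-0 n zero
pascal^-0 (suc n) (suc j) = cong₂ _+_ (pascal^-0 n (suc j)) (pascal^-0 n j)

pascal^-pascal : ∀ n f j → pascal^ n (pascal f) j ≡ pascal^ (suc n) f j
pascal^-pascal zero f j = refl
pascal^-pascal (suc n) f j = pascal-cong (pascal^-pascal n f) j

pascal^-δ : ∀ n j → pascal^ n δ j ≡ n C j
pascal^-δ zero zero = refl
pascal^-δ zero (suc j) = refl
pascal^-δ (suc n) zero = pascal^-δ n zero
pascal^-δ (suc n) (suc j) =
  trans (cong₂ _+_ (pascal^-δ n (suc j)) (pascal^-δ n j))
        (trans (+-comm (n C suc j) (n C j)) (nCk+nC[k+1]≡[n+1]C[k+1] n j))

chains-below : ∀ t v β → All (_< v) β → chains (suc t) v β ≡ 0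
chains-below t v [] h = refl
chains-below t v (y ∷ β) (y<v ∷ h) rewrite ≤⇒>ᵇ≡false {v} {y} (<⇒≤ y<v) = chains-below t v β h

chains-max : ∀ j M β → All (_< M) β → chains j M β ≡ δ j
chains-max zero M β h = refl
chains-max (suc j) M β h = chains-below j M β h

-- A chain above v in xs ++ M ∷ β either avoids M or ends at M (β lies below v).
chains-++ : ∀ t v xs M β → All (_< v) β → v < M → All (_< M) xs →
  chains (suc t) v (xs ++ M ∷ β) ≡ chains (suc t) v xs + chains t v xs
chains-++ zero v [] M β hβ v<M hx rewrite <⇒<ᵇ≡true v<M | chains-below 0 v β hβ = refl
chains-++ (suc t) v [] M β hβ v<M hx
  rewrite <⇒<ᵇ≡true v<M | chains-below (suc t) v β hβ | chains-below t M β (All.map (λ z → <-trans z v<M) hβ) = refl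
chains-++ zero v (y ∷ xs) M β hβ v<M (y<M ∷ hx) with v <ᵇ y
... | true rewrite chains-++ zero v xs M β hβ v<M hx = refl
... | false rewrite chains-++ zero v xs M β hβ v<M hx = refl
chains-++ (suc t) v (y ∷ xs) M β hβ v<M (y<M ∷ hx) with v <ᵇ y in e
... | true
  rewrite chains-++ t y xs M β (All.map (λ z → <-trans z (<ᵇ≡true⇒< e)) hβ) y<M hx
        | chains-++ (suc t) v xs M β hβ v<M hx =
  +-interchange (chains (suc t) y xs) (chains t y xs) (chains (suc (suc t)) v xs) (chains (suc t) v xs)
... | false rewrite chains-++ (suc t) v xs M β hβ v<M hx = refl

occs-max-head : ∀ M β → All (_< M) β → ∀ j → occs (M ∷ β) j ≡ occs β j
occs-max-head M [] h j = refl
occs-max-head M (b ∷ β) (b<M ∷ h) j rewrite ≤⇒>ᵇ≡false {M} {b} (<⇒≤ b<M) = refl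

-- The occurrences of 12-3-⋯-(j+2) in α M β: those in β, the ascent from the last
-- entry of α to M (j = 0), and those in α, possibly extended by M.
occs-∷-++ : ∀ a α M β → All (λ x → All (_< x) β) (a ∷ α) → All (_< M) (a ∷ α) → All (_< M) β →
  ∀ j → occs (a ∷ α ++ M ∷ β) j ≡ occs β j + (δ j + pascal (occs (a ∷ α)) j)
occs-∷-++ a [] M β (ha ∷ _) (a<M ∷ _) hβ j
  rewrite <⇒<ᵇ≡true a<M | chains-max j M β hβ | occs-max-head M β hβ j =
  trans (+-comm (δ j) (occs β j)) (cong (_+_ (occs β j)) (sym (trans (cong (_+_ (δ j)) (single j)) (+-identityʳ (δ j)))))
  where
  single : ∀ j → pascal (occs (a ∷ [])) j ≡ 0
  single zero = refl
  single (suc j) = refl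
occs-∷-++ a (b ∷ α) M β (ha ∷ hb ∷ hα) (a<M ∷ b<M ∷ hM) hβ j with a <ᵇ b
... | false = occs-∷-++ b α M β (hb ∷ hα) (b<M ∷ hM) hβ j
... | true = ascent j
  where
  IH = occs-∷-++ b α M β (hb ∷ hα) (b<M ∷ hM) hβ
  ascent : ∀ j → chains j b (α ++ M ∷ β) + occs (b ∷ α ++ M ∷ β) j ≡
                 occs β j + (δ j + pascal (λ i → chains i b α + occs (b ∷ α) i) j)
  ascent zero rewrite IH zero = sym (+-suc (occs β 0) (suc (occs (b ∷ α) 0)))
  ascent (suc j) rewrite IH (suc j) | chains-++ j b α M β hb b<M hM =
    solve 5 (λ c₁ c₀ o p₁ p₀ → (c₁ :+ c₀) :+ (o :+ (con 0 :+ (p₁ :+ p₀))) := o :+ (con 0 :+ ((c₁ :+ p₁) :+ (c₀ :+ p₀)))) refl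
      (chains (suc j) b α) (chains j b α) (occs β (suc j)) (occs (b ∷ α) (suc j)) (occs (b ∷ α) j)
    where open +-*-Solver

occs-++ : ∀ α M β → 0 < length α → All (λ x → All (_< x) β) α → All (_< M) α → All (_< M) β →
  ∀ j → occs (α ++ M ∷ β) j ≡ occs β j + (δ j + pascal (occs α) j)
occs-++ (a ∷ α) M β _ = occs-∷-++ a α M β

-- At level n the statistics of a tree permutation are transformed n times by
-- pascal; applied to the ascent term δ this yields the exponents n C j of Pₙ.
occs-treePerm : ∀ t xs → Descending xs → size t ≡ length xs →
  ∀ n j → pascal^ n (occs (treePerm t xs)) j ≡ exponent (treeWeight n t) j
occs-treePerm leaf xs d e n j = pascal^-0 n j
occs-treePerm (node leaf b) (M ∷ rest) (M> ∷ d) e n j =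
  trans (pascal^-cong n (occs-max-head M (treePerm b rest) (All-treePerm b rest (suc-injective e) M>)) j)
        (occs-treePerm b rest d (suc-injective e) n j)
occs-treePerm (node a@(node _ _) b) (M ∷ rest) (M> ∷ d) e n j = begin
  pascal^ n (occs (α ++ M ∷ β)) j
    ≡⟨ pascal^-cong n split j ⟩
  pascal^ n (λ i → occs β i + (δ i + pascal (occs α) i)) j
    ≡⟨ pascal^-+ n (occs β) (λ i → δ i + pascal (occs α) i) j ⟩
  pascal^ n (occs β) j + pascal^ n (λ i → δ i + pascal (occs α) i) j
    ≡⟨ cong (_+_ (pascal^ n (occs β) j)) (pascal^-+ n δ (pascal (occs α)) j) ⟩
  pascal^ n (occs β) j + (pascal^ n δ j + pascal^ n (pascal (occs α)) j)
    ≡⟨ cong₂ _+_ (occs-treePerm b ys (APP.drop⁺ (size a) d) (proj₂ sl) n j)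
                 (cong₂ _+_ (trans (pascal^-δ n j) (sym (exponent-pascalRow n j)))
                            (trans (pascal^-pascal n (occs α) j) (occs-treePerm a zs (APP.take⁺ (size a) d) (proj₁ sl) (suc n) j))) ⟩
  exponent (treeWeight n b) j + (exponent (pascalRow n) j + exponent (treeWeight (suc n) a) j)
    ≡⟨ +-comm (exponent (treeWeight n b) j) _ ⟩
  (exponent (pascalRow n) j + exponent (treeWeight (suc n) a) j) + exponent (treeWeight n b) j
    ≡⟨ cong (_+ exponent (treeWeight n b) j) (sym (exponent-+ₘ (pascalRow n) (treeWeight (suc n) a) j)) ⟩
  exponent (pascalRow n +ₘ treeWeight (suc n) a) j + exponent (treeWeight n b) j
    ≡⟨ sym (exponent-+ₘ (pascalRow n +ₘ treeWeight (suc n) a) (treeWeight n b) j) ⟩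
  exponent (treeWeight n (node a b)) j ∎
  where
  open ≡-Reasoning
  sl = length-take-drop (size a) (size b) rest (suc-injective e)
  zs = take (size a) rest
  ys = drop (size a) rest
  α = treePerm a zs
  β = treePerm b ys
  split : ∀ i → occs (α ++ M ∷ β) i ≡ occs β i + (δ i + pascal (occs α) i)
  split = occs-++ α M β (subst (0 <_) (sym (length-treePerm a zs (proj₁ sl))) (s≤s z≤n))
    (All-treePerm a zs (proj₁ sl) (All.map (All-treePerm b ys (proj₂ sl)) (Descending-take-drop (size a) rest d)))
    (All-treePerm a zs (proj₁ sl) (AllP.take⁺ (size a) M>))
    (All-treePerm b ys (proj₂ sl) (AllP.drop⁺ (size a) M>))

exponent-applyUpTo : ∀ (f : ℕ → ℕ) N j → exponent (applyUpTo f N) j ≡ (if j <ᵇ N then f j else 0)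
exponent-applyUpTo f zero j = refl
exponent-applyUpTo f (suc N) zero = refl
exponent-applyUpTo f (suc N) (suc j) = exponent-applyUpTo (λ i → f (suc i)) N j

if-then-0 : ∀ b {n : ℕ} → n ≡ 0 → (if b then n else 0) ≡ 0
if-then-0 true e = e
if-then-0 false e = refl

chains-short : ∀ t v xs → length xs < t → chains t v xs ≡ 0
chains-short (suc t) v [] lt = refl
chains-short (suc t) v (y ∷ ys) (s≤s lt) =
  cong₂ _+_ (if-then-0 (v <ᵇ y) (chains-short t y ys lt)) (chains-short (suc t) v ys (m<n⇒m<1+n lt))

occ-short : ∀ j π → length π ≤ suc j → occ (suc (suc j)) π ≡ 0
occ-short j [] le = refl
occ-short j (a ∷ []) le = refl
occ-short j (a ∷ b ∷ rest) (s≤s le) =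
  cong₂ _+_ (if-then-0 (a <ᵇ b) (chains-short j b rest le)) (occ-short j (b ∷ rest) (m<n⇒m<1+n le))

exponent-weight-0 : ∀ π → exponent (weight π) 0 ≡ length π
exponent-weight-0 [] = refl
exponent-weight-0 (x ∷ π) = refl

exponent-weight-suc : ∀ π j → exponent (weight π) (suc j) ≡ occs π j
exponent-weight-suc π j =
  trans (cong (λ ν → exponent ν (suc j)) (LP.map-upTo (λ k → e (suc k) π) (length π)))
        (trans (exponent-applyUpTo (λ k → e (suc k) π) (length π) (suc j)) (truncate (suc j <ᵇ length π) refl))
  where
  truncate : ∀ b → (suc j <ᵇ length π) ≡ b → (if b then occ (suc (suc j)) π else 0) ≡ occs π j
  truncate true _ = refl
  truncate false j≥ = sym (occ-short j π (≮⇒≥ (λ lt → subst T j≥ (<⇒<ᵇ lt))))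

weight-treePerm : ∀ t xs → Descending xs → size t ≡ length xs → weight (treePerm t xs) ≈ₘ length xs ∷ treeWeight 0 t
weight-treePerm t xs d e = mk≈ λ
  { zero → trans (exponent-weight-0 (treePerm t xs)) (trans (length-treePerm t xs e) e)
  ; (suc j) → trans (exponent-weight-suc (treePerm t xs) j) (occs-treePerm t xs d e 0 j) }

sameMon-weight-treePerm : ∀ t xs μ → Descending xs → size t ≡ length xs → length xs ≡ x1exp μ →
  sameMon (weight (treePerm t xs)) μ ≡ sameMon (treeWeight 0 t) (tailₘ μ)
sameMon-weight-treePerm t xs μ d e len≡ =
  trans (sameMon-resp _ _ μ μ (weight-treePerm t xs d e) ≈ₘ-refl)
        (trans (sameMon-cons (length xs) (treeWeight 0 t) μ) (cong (_∧ sameMon (treeWeight 0 t) (tailₘ μ)) (≡⇒≡ᵇ≡true len≡)))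

series-treeWeights≗genS132 : ∀ μ → series (treeWeights 0) μ ≡ genS132 μ
series-treeWeights≗genS132 μ = cong +_ (begin
  countB (λ ρ → sameMon ρ (tailₘ μ)) (map (treeWeight 0) (Trees L))
    ≡⟨ countB-map _ (treeWeight 0) (Trees L) ⟩
  countB (λ t → sameMon (treeWeight 0 t) (tailₘ μ)) (Trees L)
    ≡⟨ countB-cong-local _ _ (Trees L) (λ t m → sym (sameMon-weight-treePerm t (downFrom L) μ
                                                     (Descending-downFrom L) (size-Trees L t m) (LP.length-downFrom L))) ⟩
  countB (λ t → sameMon (weight (treePerm t (downFrom L))) μ) (Trees L)
    ≡⟨ sym (countB-map (λ π → sameMon (weight π) μ) (λ t → treePerm t (downFrom L)) (Trees L)) ⟩
  countB (λ π → sameMon (weight π) μ) (avoiders L)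
    ≡⟨ sym (countB-∧-restrict avoids132 (λ π → sameMon (weight π) μ) (Perms L) (avoiders L)
              (perms-unique (upTo L) (UP.upTo⁺ L)) (avoiders-unique L) (∈-avoiders⁻ L) (∈-avoiders⁺ L)) ⟩
  countB (λ π → avoids132 π ∧ sameMon (weight π) μ) (Perms L) ∎)
  where
  open ≡-Reasoning
  L = x1exp μ

theorem2p2 : (μ : Monomial) → ∃ λ N → (m : ℕ) → N ≤ m → cf m 0 μ ≡ genS132 μ
theorem2p2 μ = suc (x1exp μ) , λ m x1exp<m → trans (cf≗series-treeWeights m 0 μ x1exp<m) (series-treeWeights≗genS132 μ)
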